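{- Let $\varphi\colon A^*\to A^*$ be a non-erasing substitution on a finite alphabet $A$, and let $\varphi$ be prolongable on a letter $a\in A$. There is an algorithm that decides whether the infinite word $\varphi^\infty(a)$ has only finitely many distinct $\varphi$-bounded factors. If there are infinitely many, the algorithm finds a nonempty word $U$ such that $U^k$ is a factor of $\varphi^\infty(a)$ for every $k\in\mathbb N$. If there are finitely many, the algorithm computes all of them.
   Context: A substitution $\varphi$ is non-erasing if $\varphi(b)\neq\varepsilon$ for every letter $b$. It is prolongable on $a$ if $\varphi(a)=av$ with $\varphi^k(v)\neq\varepsilon$ for all $k$; then $\varphi^\infty(a)=av\varphi(v)\varphi^2(v)\cdots$. A finite word $w\in A^*$ is $\varphi$-bounded if the sequence $w,\varphi(w),\varphi^2(w),\dots$ is eventually periodic. Otherwise $|\varphi^n(w)|\to\infty$ and $w$ is called $\varphi$-growing. -}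

module Defs where

open import Data.Nat using (ℕ; zero; suc; _+_; _<_; _≤_)
open import Data.Fin using (Fin)
open import Data.List using (List; []; _∷_; length; concatMap; lookup)
open import Data.List.Membership.Propositional using (_∈_)
open import Data.Product using (Σ; ∃; _×_; _,_)
open import Data.Sum using (_⊎_)
open import Relation.Binary.PropositionalEquality using (_≡_; _≢_)
open import Relation.Nullary using (¬_)
open import Function using (_⇔_)

Word : ℕ → Set
Word n = List (Fin n)

InfWord : ℕ → Set
InfWord n = ℕ → Fin n

Subst : ℕ → Set
Subst n = Fin n → Word n

apply : ∀ {n} → Subst n → Word n → Word n
apply φ w = concatMap φ w

iter : ∀ {n} → Subst n → ℕ → Word n → Word n
iter φ zero    w = w
iter φ (suc k) w = apply φ (iter φ k w)

NonErasing : ∀ {n} → Subst n → Set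
NonErasing {n} φ = (b : Fin n) → φ b ≢ []

Prolongable : ∀ {n} → Subst n → Fin n → Set
Prolongable {n} φ a = Σ (Word n) λ v → (φ a ≡ a ∷ v) × ((k : ℕ) → iter φ k v ≢ [])

OccursAt : ∀ {n} → Word n → InfWord n → ℕ → Set
OccursAt w x i = (j : Fin (length w)) → x (i + Data.Fin.toℕ j) ≡ lookup w j

IsPrefix : ∀ {n} → Word n → InfWord n → Set
IsPrefix w x = OccursAt w x 0

Factor : ∀ {n} → Word n → InfWord n → Set
Factor w x = ∃ λ i → OccursAt w x i

-- x = φ^∞(a): every φ^m(a) is a prefix of x (these prefixes have unbounded length
-- under prolongability, so this determines x uniquely).
IsFixedPointFrom : ∀ {n} → Subst n → Fin n → InfWord n → Set
IsFixedPointFrom φ a x = (m : ℕ) → IsPrefix (iter φ m (a ∷ [])) x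

Bounded : ∀ {n} → Subst n → Word n → Set
Bounded φ w = Σ ℕ λ N → Σ ℕ λ p → (0 < p) × ((m : ℕ) → N ≤ m → iter φ (m + p) w ≡ iter φ m w)

BoundedFactor : ∀ {n} → Subst n → InfWord n → Word n → Set
BoundedFactor φ x w = Factor w x × Bounded φ w

FinitelyManyBoundedFactors : ∀ {n} → Subst n → InfWord n → Set
FinitelyManyBoundedFactors {n} φ x =
  Σ (List (Word n)) λ L → (w : Word n) → BoundedFactor φ x w → w ∈ L

pow : ∀ {n} → Word n → ℕ → Word n
pow U zero    = []
pow U (suc k) = U Data.List.++ pow U k

-- A letter b is growing when |φᵏ(b)| is unbounded. This is decidable: it happens iff b reaches,
-- in between n and 2n steps, a letter whose image has length at least 2. Past n steps a
-- non-growing word consists of letters that φ maps to single letters, so it is eventually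
-- periodic with period n!; hence a word is φ-bounded iff its letters are non-growing, and
-- ψ = φ^T with T = 2n·n! is idempotent on such words. Write ψ(h) = P h′ S with h′ its last growing letter; h ↦ h′ is an idempotent map
-- of letters. If some growing letter h of x has h′ = h and S ≠ ε, then ψᵏ⁺¹(h) ends with
-- h S Uᵏ where U = ψ(S) is non-growing, so x has infinitely many bounded factors; symmetrically
-- for the first growing letter. Otherwise the non-growing gaps between consecutive growing letters
-- of each level are stable after two further applications of ψ, so every bounded factor of x
-- already occurs in ψ⁴(a).

module Submission where

open import Defs
open import Data.Nat hiding (_^_)
open import Data.Nat.Properties
open import Data.Nat.Divisibility using (_∣_; divides; ∣-trans; m≤n⇒m!∣n!)
open import Data.Nat.Induction using (<-rec)
open import Data.Nat.Tactic.RingSolver using (solve-∀)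
open import Algebra.Properties.CommutativeSemigroup +-commutativeSemigroup using (xy∙z≈xz∙y)
open import Data.Fin using (Fin; zero; suc; toℕ; fromℕ<)
open import Data.Fin.Properties using (pigeonhole; toℕ<n; toℕ-fromℕ<)
open import Data.List.Extrema.Nat using (argmax; f[xs]≤f[argmax])
import Data.Fin.Properties as Fin
open import Data.List using (List; []; _∷_; [_]; _++_; length; map; concat; filter)
open import Data.List.Properties
  using (++-assoc; ++-identityʳ; length-++; map-++; map-cong; concat-++; ∷-injectiveˡ; ∷-injectiveʳ; ≡-dec)
open import Data.List.Membership.Propositional using (_∈_; find; lose)
open import Data.List.Membership.Propositional.Properties
  using (∈-++⁺ˡ; ∈-++⁺ʳ; ∈-++⁻; ∈-map⁺; ∈-map⁻; ∈-filter⁺; ∈-filter⁻)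
open import Data.List.Relation.Unary.Any using (here; there; any?)
open import Data.List.Relation.Unary.All as All using (All; []; _∷_)
import Data.List.Relation.Unary.All.Properties as All
open import Data.Product using (Σ; ∃; ∃₂; _×_; _,_; proj₁; proj₂)
open import Data.Unit using (⊤; tt)
open import Data.Sum using (_⊎_; inj₁; inj₂)
open import Relation.Binary.PropositionalEquality hiding ([_])
open import Relation.Nullary using (¬_; Dec; yes; no; ¬?)
open import Relation.Nullary.Decidable using (map′; _×-dec_; _⊎-dec_)
open import Data.Empty using (⊥-elim)
import Function.Endo.Propositional as Endo
open import Function using (_∘_; _⇔_; mk⇔)

infix 4 _⊑_

_⊑_ : ∀ {A : Set} → List A → List A → Set
w ⊑ z = ∃₂ λ P S → z ≡ P ++ w ++ S

module _ {A : Set} where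

  ⊑-refl : (w : List A) → w ⊑ w
  ⊑-refl w = [] , [] , sym (++-identityʳ w)

  ⊑-trans : {u v w : List A} → u ⊑ v → v ⊑ w → u ⊑ w
  ⊑-trans {u} (P , S , refl) (P′ , S′ , refl) = P′ ++ P , S ++ S′ , reassociate
    where
    open ≡-Reasoning
    reassociate : P′ ++ (P ++ u ++ S) ++ S′ ≡ (P′ ++ P) ++ u ++ S ++ S′
    reassociate = begin
      P′ ++ (P ++ u ++ S) ++ S′  ≡⟨ cong (P′ ++_) (++-assoc P (u ++ S) S′) ⟩
      P′ ++ P ++ (u ++ S) ++ S′  ≡⟨ cong (λ z → P′ ++ P ++ z) (++-assoc u S S′) ⟩
      P′ ++ P ++ u ++ S ++ S′    ≡⟨ ++-assoc P′ P (u ++ S ++ S′) ⟨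
      (P′ ++ P) ++ u ++ S ++ S′  ∎

  []⊑ : (z : List A) → [] ⊑ z
  []⊑ z = [] , z , refl

  ⊑-++ˡ : ∀ {w z} (P : List A) → w ⊑ z → w ⊑ P ++ z
  ⊑-++ˡ {w} P (P′ , S , refl) = P ++ P′ , S , sym (++-assoc P P′ (w ++ S))

  prefix⊑ : (w S : List A) → w ⊑ w ++ S
  prefix⊑ w S = [] , S , refl

  suffix⊑ : (P w : List A) → w ⊑ P ++ w
  suffix⊑ P w = ⊑-++ˡ P (⊑-refl w)

  ⊑-middle : ∀ (P s m p R : List A) → s ++ m ++ p ⊑ (P ++ s) ++ m ++ p ++ R
  ⊑-middle P s m p R = P , R , (begin
    (P ++ s) ++ m ++ p ++ R    ≡⟨ ++-assoc P s _ ⟩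
    P ++ s ++ m ++ p ++ R      ≡⟨ cong (λ w → P ++ s ++ w) (++-assoc m p R) ⟨
    P ++ s ++ (m ++ p) ++ R    ≡⟨ cong (P ++_) (++-assoc s (m ++ p) R) ⟨
    P ++ (s ++ m ++ p) ++ R    ∎)
    where open ≡-Reasoning

  ∈⇒[]⊑ : ∀ {c : A} {z} → c ∈ z → [ c ] ⊑ z
  ∈⇒[]⊑ {z = _ ∷ z} (here refl) = [] , z , refl
  ∈⇒[]⊑ {z = d ∷ _} (there c∈) = ⊑-++ˡ [ d ] (∈⇒[]⊑ c∈)

  ∈-⊑ : ∀ {c : A} {u z} → c ∈ u → u ⊑ z → c ∈ z
  ∈-⊑ c∈ (P , S , refl) = ∈-++⁺ʳ P (∈-++⁺ˡ c∈)

  ∉⇒prefix : ∀ {c : A} w {S X Y} → ¬ c ∈ w → w ++ S ≡ X ++ c ∷ Y → ∃ λ S′ → X ≡ w ++ S′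
  ∉⇒prefix []      {X = X}     c∉ _  = X , refl
  ∉⇒prefix (d ∷ w) {X = []}    c∉ eq = ⊥-elim (c∉ (here (sym (∷-injectiveˡ eq))))
  ∉⇒prefix (d ∷ w) {X = _ ∷ _} c∉ eq with refl ← ∷-injectiveˡ eq
    with S′ , X≡ ← ∉⇒prefix w (λ c∈ → c∉ (there c∈)) (∷-injectiveʳ eq) = S′ , cong (d ∷_) X≡

  ⊑-∉-split : ∀ {c : A} {w} X Y → ¬ c ∈ w → w ⊑ X ++ c ∷ Y → w ⊑ X ⊎ w ⊑ Y
  ⊑-∉-split {w = []}    X       Y c∉ _                 = inj₁ ([]⊑ X)
  ⊑-∉-split {w = _ ∷ _} []      Y c∉ ([]    , S , eq) = ⊥-elim (c∉ (here (∷-injectiveˡ eq)))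
  ⊑-∉-split             []      Y c∉ (_ ∷ P , S , eq) = inj₂ (P , S , ∷-injectiveʳ eq)
  ⊑-∉-split {w = w}     (x ∷ X) Y c∉ ([]    , S , eq) with S′ , X≡ ← ∉⇒prefix w c∉ (sym eq) =
    inj₁ ([] , S′ , X≡)
  ⊑-∉-split             (x ∷ X) Y c∉ (_ ∷ P , S , eq) with ⊑-∉-split X Y c∉ (P , S , ∷-injectiveʳ eq)
  ... | inj₁ w⊑X = inj₁ (⊑-++ˡ [ x ] w⊑X)
  ... | inj₂ w⊑Y = inj₂ w⊑Y

  prefixes : List A → List (List A)
  prefixes []      = [ [] ]
  prefixes (c ∷ z) = [] ∷ map (c ∷_) (prefixes z)

  factors : List A → List (List A)
  factors []      = [ [] ]
  factors (c ∷ z) = prefixes (c ∷ z) ++ factors z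

  ∈-prefixes⁻ : ∀ {w} z → w ∈ prefixes z → ∃ λ S → z ≡ w ++ S
  ∈-prefixes⁻ []      (here refl) = [] , refl
  ∈-prefixes⁻ (c ∷ z) (here refl) = c ∷ z , refl
  ∈-prefixes⁻ (c ∷ z) (there w∈) with w′ , w′∈ , refl ← ∈-map⁻ (c ∷_) w∈
    with S , z≡ ← ∈-prefixes⁻ z w′∈ = S , cong (c ∷_) z≡

  ∈-prefixes⁺ : ∀ w {z} S → z ≡ w ++ S → w ∈ prefixes z
  ∈-prefixes⁺ []      {[]}    S _  = here refl
  ∈-prefixes⁺ []      {_ ∷ _} S _  = here refl
  ∈-prefixes⁺ (c ∷ w) {_ ∷ z} S eq with refl ← ∷-injectiveˡ eq =
    there (∈-map⁺ (c ∷_) (∈-prefixes⁺ w S (∷-injectiveʳ eq)))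

  ∈-factors⁻ : ∀ {w} z → w ∈ factors z → w ⊑ z
  ∈-factors⁻ []      (here refl) = []⊑ []
  ∈-factors⁻ (c ∷ z) w∈ with ∈-++⁻ (prefixes (c ∷ z)) w∈
  ... | inj₁ w∈prefixes with S , z≡ ← ∈-prefixes⁻ (c ∷ z) w∈prefixes = [] , S , z≡
  ... | inj₂ w∈factors = ⊑-++ˡ [ c ] (∈-factors⁻ z w∈factors)

  ∈-factors⁺ : ∀ {w} z → w ⊑ z → w ∈ factors z
  ∈-factors⁺ {[]}    []      _                 = here refl
  ∈-factors⁺ {_ ∷ _} []      ([] , _ , ())
  ∈-factors⁺ {_ ∷ _} []      (_ ∷ _ , _ , ())
  ∈-factors⁺ {w}     (c ∷ z) ([]    , S , z≡) = ∈-++⁺ˡ (∈-prefixes⁺ w S z≡)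
  ∈-factors⁺         (c ∷ z) (_ ∷ P , S , z≡) =
    ∈-++⁺ʳ (prefixes (c ∷ z)) (∈-factors⁺ z (P , S , ∷-injectiveʳ z≡))

  ¬≢[]⇒≡[] : ∀ {w : List A} → ¬ w ≢ [] → w ≡ []
  ¬≢[]⇒≡[] {[]}    _       = refl
  ¬≢[]⇒≡[] {_ ∷ _} ¬w≢[] = ⊥-elim (¬w≢[] λ ())

  ≢[]⇒length>0 : ∀ {w : List A} → w ≢ [] → length w > 0
  ≢[]⇒length>0 {[]}    w≢[] = ⊥-elim (w≢[] refl)
  ≢[]⇒length>0 {_ ∷ _} _    = z<s

  length-⊑ : ∀ {u z : List A} → u ⊑ z → length u ≤ length z
  length-⊑ {u} (P , S , refl) rewrite length-++ P {u ++ S} | length-++ u {S} =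
    ≤-trans (m≤m+n (length u) (length S)) (m≤n+m _ (length P))

pow-++-comm : ∀ {n} (U : Word n) k → pow U k ++ U ≡ U ++ pow U k
pow-++-comm U zero    = sym (++-identityʳ U)
pow-++-comm U (suc k) = trans (++-assoc U (pow U k) U) (cong (U ++_) (pow-++-comm U k))

length-pow : ∀ {n} {U : Word n} → U ≢ [] → ∀ k → k ≤ length (pow U k)
length-pow U≢[] zero = z≤n
length-pow {U = U} U≢[] (suc k) rewrite length-++ U {pow U k} = +-mono-≤ (≢[]⇒length>0 U≢[]) (length-pow U≢[] k)

module InfiniteWord {n : ℕ} (x : InfWord n) where

  slice : ℕ → ℕ → Word n
  slice i zero    = []
  slice i (suc l) = x i ∷ slice (suc i) l

  occursAt⇒≡slice : ∀ w i → OccursAt w x i → w ≡ slice i (length w)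
  occursAt⇒≡slice []      i occurs = refl
  occursAt⇒≡slice (c ∷ w) i occurs =
    cong₂ _∷_ (sym (trans (cong x (sym (+-identityʳ i))) (occurs zero)))
              (occursAt⇒≡slice w (suc i) λ j → trans (cong x (sym (+-suc i (toℕ j)))) (occurs (suc j)))

  ≡slice⇒occursAt : ∀ w i → w ≡ slice i (length w) → OccursAt w x i
  ≡slice⇒occursAt (c ∷ w) i w≡ zero    = trans (cong x (+-identityʳ i)) (sym (∷-injectiveˡ w≡))
  ≡slice⇒occursAt (c ∷ w) i w≡ (suc j) =
    trans (cong x (+-suc i (toℕ j))) (≡slice⇒occursAt w (suc i) (∷-injectiveʳ w≡) j)

  slice-+ : ∀ i l l′ → slice i (l + l′) ≡ slice i l ++ slice (i + l) l′
  slice-+ i zero    l′ = cong (λ j → slice j l′) (sym (+-identityʳ i))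
  slice-+ i (suc l) l′ =
    cong (x i ∷_) (trans (slice-+ (suc i) l l′) (cong (λ j → slice (suc i) l ++ slice j l′) (sym (+-suc i l))))

  ++≡slice : ∀ u {v} i → u ++ v ≡ slice i (length (u ++ v)) →
             u ≡ slice i (length u) × v ≡ slice (length u + i) (length v)
  ++≡slice []      i v≡ = refl , v≡
  ++≡slice (c ∷ u) {v} i u++v≡ with u≡ , v≡ ← ++≡slice u (suc i) (∷-injectiveʳ u++v≡) =
    cong₂ _∷_ (∷-injectiveˡ u++v≡) u≡ , subst (λ j → v ≡ slice j (length v)) (+-suc (length u) i) v≡

  prefix⇒≡slice : ∀ {z} → IsPrefix z x → z ≡ slice 0 (length z)
  prefix⇒≡slice {z} = occursAt⇒≡slice z 0

  ⊑prefix⇒factor : ∀ {w z} → IsPrefix z x → w ⊑ z → Factor w x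
  ⊑prefix⇒factor {w} z-prefix (P , S , refl)
    with _ , w++S≡ ← ++≡slice P 0 (prefix⇒≡slice z-prefix)
    with w≡ , _ ← ++≡slice w (length P + 0) w++S≡ =
    length P + 0 , ≡slice⇒occursAt w (length P + 0) w≡

  factor⇒⊑prefix : ∀ {w z} ((i , _) : Factor w x) → IsPrefix z x → i + length w ≤ length z → w ⊑ z
  factor⇒⊑prefix {w} {z} (i , occurs) z-prefix i+|w|≤|z| = slice 0 i , slice (i + length w) r , z≡
    where
    open ≡-Reasoning
    r = length z ∸ (i + length w)
    z≡ : z ≡ slice 0 i ++ w ++ slice (i + length w) r
    z≡ = begin
      z                                      ≡⟨ prefix⇒≡slice z-prefix ⟩
      slice 0 (length z)                     ≡⟨ cong (slice 0) (m+[n∸m]≡n i+|w|≤|z|) ⟨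
      slice 0 (i + length w + r)             ≡⟨ cong (slice 0) (+-assoc i (length w) r) ⟩
      slice 0 (i + (length w + r))           ≡⟨ slice-+ 0 i (length w + r) ⟩
      slice 0 i ++ slice i (length w + r)    ≡⟨ cong (slice 0 i ++_) (slice-+ i (length w) r) ⟩
      slice 0 i ++ slice i (length w) ++ slice (i + length w) r
        ≡⟨ cong (λ u → slice 0 i ++ u ++ slice (i + length w) r) (occursAt⇒≡slice w i occurs) ⟨
      slice 0 i ++ w ++ slice (i + length w) r ∎

0<m≤n⇒m∣n! : ∀ {m n} → 0 < m → m ≤ n → m ∣ n !
0<m≤n⇒m∣n! {suc m} _ m<n = ∣-trans (divides (m !) (*-comm (suc m) (m !))) (m≤n⇒m!∣n! m<n)

module Iteration {n : ℕ} (f : Fin n → Fin n) where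
  open Endo (Fin n) using (_^_; ^-homo)

  ^-+ : ∀ i j c → (f ^ (i + j)) c ≡ (f ^ i) ((f ^ j) c)
  ^-+ i j c = cong-app (^-homo f i j) c

  ^-cycle : ∀ {d i c} → (f ^ (d + i)) c ≡ (f ^ i) c →
            ∀ {k} → i ≤ k → ∀ t → (f ^ (k + t * d)) c ≡ (f ^ k) c
  ^-cycle {d} {i} {c} eq {k} i≤k t = begin
    (f ^ (k + t * d)) c              ≡⟨ cong (λ m → (f ^ m) c) k≡ ⟩
    (f ^ ((k ∸ i) + (t * d + i))) c  ≡⟨ ^-+ (k ∸ i) (t * d + i) c ⟩
    (f ^ (k ∸ i)) ((f ^ (t * d + i)) c) ≡⟨ cong (f ^ (k ∸ i)) (cycles t) ⟩
    (f ^ (k ∸ i)) ((f ^ i) c)        ≡⟨ ^-+ (k ∸ i) i c ⟨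
    (f ^ ((k ∸ i) + i)) c            ≡⟨ cong (λ m → (f ^ m) c) (m∸n+n≡m i≤k) ⟩
    (f ^ k) c                        ∎
    where
    open ≡-Reasoning
    cycles : ∀ t → (f ^ (t * d + i)) c ≡ (f ^ i) c
    cycles zero = refl
    cycles (suc t) = begin
      (f ^ ((d + t * d) + i)) c       ≡⟨ cong (λ m → (f ^ m) c) (+-assoc d (t * d) i) ⟩
      (f ^ (d + (t * d + i))) c       ≡⟨ ^-+ d (t * d + i) c ⟩
      (f ^ d) ((f ^ (t * d + i)) c)   ≡⟨ cong (f ^ d) (cycles t) ⟩
      (f ^ d) ((f ^ i) c)             ≡⟨ ^-+ d i c ⟨
      (f ^ (d + i)) c                 ≡⟨ eq ⟩
      (f ^ i) c                       ∎
    k≡ : k + t * d ≡ (k ∸ i) + (t * d + i)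
    k≡ = begin
      k + t * d              ≡⟨ cong (_+ t * d) (m∸n+n≡m i≤k) ⟨
      (k ∸ i) + i + t * d    ≡⟨ +-assoc (k ∸ i) i (t * d) ⟩
      (k ∸ i) + (i + t * d)  ≡⟨ cong ((k ∸ i) +_) (+-comm i (t * d)) ⟩
      (k ∸ i) + (t * d + i)  ∎

  ^-eventually-periodic : ∀ c {k} → n ≤ k → ∀ t → (f ^ (k + t * n !)) c ≡ (f ^ k) c
  ^-eventually-periodic c {k} n≤k t with pigeonhole (n<1+n n) (λ i → (f ^ toℕ i) c)
  ... | i , j , i<j , fⁱc≡fʲc
    with 0<m≤n⇒m∣n! (m<n⇒0<n∸m i<j) (≤-trans (m∸n≤m (toℕ j) (toℕ i)) (≤-pred (toℕ<n j)))
  ...   | divides q n!≡q*d =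
    trans (cong (λ m → (f ^ (k + m)) c) t*n!≡) (^-cycle returns (≤-trans (≤-pred (toℕ<n i)) n≤k) (t * q))
    where
    d = toℕ j ∸ toℕ i
    returns : (f ^ (d + toℕ i)) c ≡ (f ^ toℕ i) c
    returns = trans (cong (λ m → (f ^ m) c) (m∸n+n≡m (<⇒≤ i<j))) (sym fⁱc≡fʲc)
    t*n!≡ : t * n ! ≡ t * q * d
    t*n!≡ = trans (cong (t *_) n!≡q*d) (sym (*-assoc t q d))

module Morphism {n : ℕ} (φ : Subst n) where

  apply-++ : ∀ u v → apply φ (u ++ v) ≡ apply φ u ++ apply φ v
  apply-++ u v = trans (cong concat (map-++ φ u v)) (sym (concat-++ (map φ u) (map φ v)))

  apply-[-] : ∀ c → apply φ [ c ] ≡ φ c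
  apply-[-] c = ++-identityʳ (φ c)

  iter-++ : ∀ k u v → iter φ k (u ++ v) ≡ iter φ k u ++ iter φ k v
  iter-++ zero    u v = refl
  iter-++ (suc k) u v = trans (cong (apply φ) (iter-++ k u v)) (apply-++ (iter φ k u) (iter φ k v))

  iter-[] : ∀ k → iter φ k [] ≡ []
  iter-[] zero    = refl
  iter-[] (suc k) = cong (apply φ) (iter-[] k)

  iter-+ : ∀ i j w → iter φ (i + j) w ≡ iter φ i (iter φ j w)
  iter-+ zero    j w = refl
  iter-+ (suc i) j w = cong (apply φ) (iter-+ i j w)

  iter-suc : ∀ k w → iter φ (suc k) w ≡ iter φ k (apply φ w)
  iter-suc k w = trans (cong (λ m → iter φ m w) (+-comm 1 k)) (iter-+ k 1 w)

  iter-⊑ : ∀ k {u z} → u ⊑ z → iter φ k u ⊑ iter φ k z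
  iter-⊑ k {u} (P , S , refl) =
    iter φ k P , iter φ k S , trans (iter-++ k P (u ++ S)) (cong (iter φ k P ++_) (iter-++ k u S))

  ∈-iter⁻ : ∀ k w {e} → e ∈ iter φ k w → ∃ λ d → d ∈ w × e ∈ iter φ k [ d ]
  ∈-iter⁻ k []      e∈ rewrite iter-[] k with () ← e∈
  ∈-iter⁻ k (c ∷ w) e∈ rewrite iter-++ k [ c ] w with ∈-++⁻ (iter φ k [ c ]) e∈
  ... | inj₁ e∈c = c , here refl , e∈c
  ... | inj₂ e∈w with d , d∈ , e∈d ← ∈-iter⁻ k w e∈w = d , there d∈ , e∈d

  apply-middle : ∀ P S {c X l Y} → φ c ≡ X ++ l ∷ Y →
                 apply φ (P ++ c ∷ S) ≡ (apply φ P ++ X) ++ l ∷ Y ++ apply φ S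
  apply-middle P S {c} {X} {l} {Y} φc≡ = begin
    apply φ (P ++ c ∷ S)                 ≡⟨ apply-++ P (c ∷ S) ⟩
    apply φ P ++ φ c ++ apply φ S        ≡⟨ cong (λ w → apply φ P ++ w ++ apply φ S) φc≡ ⟩
    apply φ P ++ (X ++ l ∷ Y) ++ apply φ S ≡⟨ cong (apply φ P ++_) (++-assoc X (l ∷ Y) (apply φ S)) ⟩
    apply φ P ++ X ++ l ∷ Y ++ apply φ S   ≡⟨ ++-assoc (apply φ P) X _ ⟨
    (apply φ P ++ X) ++ l ∷ Y ++ apply φ S ∎
    where open ≡-Reasoning

  apply-pow : ∀ {U} → apply φ U ≡ U → ∀ k → apply φ (pow U k) ≡ pow U k
  apply-pow φU≡U zero    = refl
  apply-pow {U} φU≡U (suc k) = trans (apply-++ U (pow U k)) (cong₂ _++_ φU≡U (apply-pow φU≡U k))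

  module _ {h P S} (φh≡ : φ h ≡ P ++ h ∷ S) (φU≡U : apply φ (apply φ S) ≡ apply φ S) where
    private U = apply φ S

    iter-ends-with : ∀ k → ∃ λ X → iter φ (suc k) [ h ] ≡ X ++ h ∷ S ++ pow U k
    iter-ends-with zero = P , trans (apply-[-] h) (trans φh≡ (cong (λ w → P ++ h ∷ w) (sym (++-identityʳ S))))
    iter-ends-with (suc k) with X , iter≡ ← iter-ends-with k =
      apply φ X ++ P , trans (cong (apply φ) iter≡) (trans (apply-middle X (S ++ pow U k) φh≡)
        (cong (λ w → (apply φ X ++ P) ++ h ∷ S ++ w) (trans (apply-++ S (pow U k)) (cong (U ++_) (apply-pow φU≡U k)))))

    pow⊑iter-right : ∀ k → pow U k ⊑ iter φ (suc k) [ h ]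
    pow⊑iter-right k with X , iter≡ ← iter-ends-with k =
      X ++ h ∷ S , [] , trans iter≡ (trans (cong (λ w → X ++ h ∷ S ++ w) (sym (++-identityʳ (pow U k))))
                                            (sym (++-assoc X (h ∷ S) (pow U k ++ []))))

  module _ {h P R} (φh≡ : φ h ≡ P ++ h ∷ R) (φU≡U : apply φ (apply φ P) ≡ apply φ P) where
    private U = apply φ P

    iter-begins-with : ∀ k → ∃ λ Y → iter φ (suc k) [ h ] ≡ pow U k ++ P ++ h ∷ Y
    iter-begins-with zero = R ++ [] , trans (apply-[-] h) (trans φh≡ (cong (λ w → P ++ h ∷ w) (sym (++-identityʳ R))))
    iter-begins-with (suc k) with Y , iter≡ ← iter-begins-with k = R ++ apply φ Y , (begin
      apply φ (iter φ (suc k) [ h ])            ≡⟨ cong (apply φ) iter≡ ⟩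
      apply φ (pow U k ++ P ++ h ∷ Y)           ≡⟨ apply-++ (pow U k) (P ++ h ∷ Y) ⟩
      apply φ (pow U k) ++ apply φ (P ++ h ∷ Y) ≡⟨ cong₂ _++_ (apply-pow φU≡U k) (apply-middle P Y φh≡) ⟩
      pow U k ++ (U ++ P) ++ h ∷ R ++ apply φ Y ≡⟨ cong (pow U k ++_) (++-assoc U P _) ⟩
      pow U k ++ U ++ P ++ h ∷ R ++ apply φ Y   ≡⟨ ++-assoc (pow U k) U _ ⟨
      (pow U k ++ U) ++ P ++ h ∷ R ++ apply φ Y ≡⟨ cong (_++ _) (pow-++-comm U k) ⟩
      (U ++ pow U k) ++ P ++ h ∷ R ++ apply φ Y ∎)
      where open ≡-Reasoning

    pow⊑iter-left : ∀ k → pow U k ⊑ iter φ (suc k) [ h ]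
    pow⊑iter-left k with Y , iter≡ ← iter-begins-with k = [] , P ++ h ∷ Y , iter≡

  infix 4 _⟶[_]_

  record _⟶[_]_ (b : Fin n) (k : ℕ) (e : Fin n) : Set where
    constructor reach
    field ∈-iter : e ∈ iter φ k [ b ]
  open _⟶[_]_ public

  ⟶-refl : ∀ {b} → b ⟶[ 0 ] b
  ⟶-refl = reach (here refl)

  ⟶-trans : ∀ {i j b c e} → b ⟶[ i ] c → c ⟶[ j ] e → b ⟶[ j + i ] e
  ⟶-trans {i} {j} {b} (reach c∈) (reach e∈) =
    reach (subst (_ ∈_) (sym (iter-+ j i [ b ])) (∈-⊑ e∈ (iter-⊑ j (∈⇒[]⊑ c∈))))

  ⟶-cons : ∀ {k b d e} → d ∈ φ b → d ⟶[ k ] e → b ⟶[ suc k ] e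
  ⟶-cons {k} {b} d∈ (reach e∈) =
    reach (subst (_ ∈_) (sym (trans (iter-suc k [ b ]) (cong (iter φ k) (apply-[-] b))))
                 (∈-⊑ e∈ (iter-⊑ k (∈⇒[]⊑ d∈))))

  ⟶-uncons : ∀ {k b e} → b ⟶[ suc k ] e → ∃ λ d → d ∈ φ b × d ⟶[ k ] e
  ⟶-uncons {k} {b} (reach e∈)
    rewrite iter-suc k [ b ] | apply-[-] b
    with d , d∈ , e∈d ← ∈-iter⁻ k (φ b) e∈ = d , d∈ , reach e∈d

  ⟶-one : ∀ {b d} → d ∈ φ b → b ⟶[ 1 ] d
  ⟶-one d∈ = ⟶-cons d∈ ⟶-refl

  ⟶-repeat : ∀ {c d} → c ⟶[ d ] c → ∀ t → c ⟶[ t * d ] c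
  ⟶-repeat c⟶c zero    = ⟶-refl
  ⟶-repeat c⟶c (suc t) = ⟶-trans (⟶-repeat c⟶c t) c⟶c

  data Path : ℕ → Fin n → Fin n → Set where
    []  : ∀ {b} → Path 0 b b
    _∷_ : ∀ {k b d e} → d ∈ φ b → Path k d e → Path (suc k) b e

  ⟶⇒Path : ∀ k {b e} → b ⟶[ k ] e → Path k b e
  ⟶⇒Path zero    (reach (here refl)) = []
  ⟶⇒Path (suc k) b⟶e with d , d∈ , d⟶e ← ⟶-uncons b⟶e = d∈ ∷ ⟶⇒Path k d⟶e

  visit : ∀ {k b e} → Path k b e → ℕ → Fin n
  visit {b = b} _       zero    = b
  visit {b = b} []      (suc i) = b
  visit         (_ ∷ p) (suc i) = visit p i

  visit-last : ∀ {k b e} (p : Path k b e) → visit p k ≡ e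
  visit-last []      = refl
  visit-last (_ ∷ p) = visit-last p

  visit-⟶ : ∀ {k b e} (p : Path k b e) i d → i + d ≤ k → visit p i ⟶[ d ] visit p (i + d)
  visit-⟶ p        zero    zero    _           = ⟶-refl
  visit-⟶ (d∈ ∷ p) zero    (suc d) (s≤s d≤k)   = ⟶-cons d∈ (visit-⟶ p zero d d≤k)
  visit-⟶ (_ ∷ p)  (suc i) d       (s≤s i+d≤k) = visit-⟶ p i d i+d≤k

  visit-⟶-∸ : ∀ {k b e} (p : Path k b e) {i j} → i ≤ j → j ≤ k → visit p i ⟶[ j ∸ i ] visit p j
  visit-⟶-∸ p {i} {j} i≤j j≤k =
    subst (λ m → visit p i ⟶[ j ∸ i ] visit p m) (m+[n∸m]≡n i≤j)
          (visit-⟶ p i (j ∸ i) (subst (_≤ _) (sym (m+[n∸m]≡n i≤j)) j≤k))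

  record Loop (k : ℕ) (b e : Fin n) : Set where
    field
      entry cycle exit : ℕ
      hub              : Fin n
      k≡               : k ≡ exit + (cycle + entry)
      cycle>0          : cycle > 0
      cycle≤n          : cycle ≤ n
      to-hub           : b ⟶[ entry ] hub
      around-hub       : hub ⟶[ cycle ] hub
      from-hub         : hub ⟶[ exit ] e

    pumped : ∀ s → b ⟶[ exit + (s * cycle + entry) ] e
    pumped s = ⟶-trans (⟶-trans to-hub (⟶-repeat around-hub s)) from-hub

  Path-loop : ∀ {k b e} → Path k b e → n ≤ k → Loop k b e
  Path-loop {k} p n≤k
    with i , j , i<j , same ← pigeonhole (n<1+n n) (λ i → visit p (toℕ i)) = record
    { entry      = toℕ i
    ; cycle      = toℕ j ∸ toℕ i
    ; exit       = k ∸ toℕ j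
    ; hub        = visit p (toℕ i)
    ; k≡         = sym (trans (cong (k ∸ toℕ j +_) (m∸n+n≡m (<⇒≤ i<j))) (m∸n+n≡m j≤k))
    ; cycle>0    = m<n⇒0<n∸m i<j
    ; cycle≤n    = ≤-trans (m∸n≤m (toℕ j) (toℕ i)) j≤n
    ; to-hub     = visit-⟶ p 0 (toℕ i) (≤-trans (<⇒≤ i<j) j≤k)
    ; around-hub = subst (λ c → _ ⟶[ _ ] c) (sym same) (visit-⟶-∸ p (<⇒≤ i<j) j≤k)
    ; from-hub   = subst₂ (λ c c′ → c ⟶[ _ ] c′) (sym same) (visit-last p) (visit-⟶-∸ p j≤k ≤-refl)
    }
    where
    j≤n = ≤-pred (toℕ<n j)
    j≤k = ≤-trans j≤n n≤k

  loop : ∀ {k b e} → b ⟶[ k ] e → n ≤ k → Loop k b e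
  loop {k} b⟶e = Path-loop (⟶⇒Path k b⟶e)

  ⟶-shorten : ∀ {k b e} → b ⟶[ k ] e → n ≤ k → ∃ λ k′ → k′ < k × k ≤ k′ + n × b ⟶[ k′ ] e
  ⟶-shorten b⟶e n≤k = exit + entry , k′<k , k≤k′+n , pumped 0
    where
    open Loop (loop b⟶e n≤k)
    k≡′ : _ ≡ (exit + entry) + cycle
    k≡′ = trans k≡ (rearrange exit cycle entry)
      where
      rearrange : ∀ x c y → x + (c + y) ≡ (x + y) + c
      rearrange = solve-∀
    k′<k = subst (exit + entry <_) (sym k≡′) (m<m+n (exit + entry) cycle>0)
    k≤k′+n = subst (_≤ exit + entry + n) (sym k≡′) (+-monoʳ-≤ (exit + entry) cycle≤n)

  ⟶-pump : ∀ {k b e} → b ⟶[ k ] e → n ≤ k → ∃ λ d → d > 0 × ∀ t → b ⟶[ k + t * d ] e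
  ⟶-pump {k} {b} {e} b⟶e n≤k =
    cycle , cycle>0 , λ t → subst (b ⟶[_] e) (sym (k+t*c≡ t)) (pumped (suc t))
    where
    open Loop (loop b⟶e n≤k)
    k+t*c≡ : ∀ t → k + t * cycle ≡ exit + (suc t * cycle + entry)
    k+t*c≡ t = trans (cong (_+ t * cycle) k≡) (rearrange exit cycle entry t)
      where
      rearrange : ∀ x c y t → x + (c + y) + t * c ≡ x + ((c + t * c) + y)
      rearrange = solve-∀

  ⟶-shortenTo : ∀ L {k b e} → L ≤ k → b ⟶[ k ] e → ∃ λ k′ → L ≤ k′ × k′ < L + n × b ⟶[ k′ ] e
  ⟶-shortenTo L {k} = <-rec Shortenable shorten k
    where
    Shortenable : ℕ → Set
    Shortenable k = ∀ {b e} → L ≤ k → b ⟶[ k ] e → ∃ λ k′ → L ≤ k′ × k′ < L + n × b ⟶[ k′ ] e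
    shorten : ∀ k → (∀ {k′} → k′ < k → Shortenable k′) → Shortenable k
    shorten k rec L≤k b⟶e with k <? L + n
    ... | yes k<L+n = k , L≤k , k<L+n , b⟶e
    ... | no  k≮L+n
      with k′ , k′<k , k≤k′+n , b⟶′e ← ⟶-shorten b⟶e (≤-trans (m≤n+m n L) (≮⇒≥ k≮L+n)) =
      rec k′<k (+-cancelʳ-≤ n L k′ (≤-trans (≮⇒≥ k≮L+n) k≤k′+n)) b⟶′e

  ⟶-bounded : ∀ {k b e} → b ⟶[ k ] e → ∃ λ k′ → k′ < n × b ⟶[ k′ ] e
  ⟶-bounded b⟶e with k′ , _ , k′<n , b⟶′e ← ⟶-shortenTo 0 z≤n b⟶e = k′ , k′<n , b⟶′e

module Growth {n : ℕ} (φ : Subst n) (φ-nonErasing : NonErasing φ) where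
  open Morphism φ
  open Iteration using (^-eventually-periodic)
  open Endo (Fin n) using (_^_)

  Expanding : Fin n → Set
  Expanding e = 2 ≤ length (φ e)

  ReachesExpanding : ℕ → Fin n → Set
  ReachesExpanding k b = ∃ λ e → b ⟶[ k ] e × Expanding e

  Growing : Fin n → Set
  Growing b = ∃ λ k → n ≤ k × ReachesExpanding k b

  NonGrowing : Fin n → Set
  NonGrowing b = ¬ Growing b

  reachesExpanding? : ∀ k b → Dec (ReachesExpanding k b)
  reachesExpanding? k b =
    map′ (λ any → let e , e∈ , exp = find any in e , reach e∈ , exp)
         (λ (e , reach e∈ , exp) → lose e∈ exp)
         (any? (λ e → 2 ≤? length (φ e)) (iter φ k [ b ]))

  -- A growing letter reaches an expanding letter in some number of steps in [n, 2n).
  growing? : ∀ b → Dec (Growing b)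
  growing? b = map′ (λ (i , r) → n + toℕ i , m≤m+n n _ , r) within-2n
                    (Fin.any? λ (i : Fin n) → reachesExpanding? (n + toℕ i) b)
    where
    within-2n : Growing b → ∃ λ (i : Fin n) → ReachesExpanding (n + toℕ i) b
    within-2n (k , n≤k , e , b⟶e , exp)
      with k′ , n≤k′ , k′<2n , b⟶′e ← ⟶-shortenTo n n≤k b⟶e =
      fromℕ< k′∸n<n , subst (λ m → ReachesExpanding m b) (sym n+i≡k′) (e , b⟶′e , exp)
      where
      k′∸n<n : k′ ∸ n < n
      k′∸n<n = +-cancelˡ-< n (k′ ∸ n) n (subst (_< n + n) (sym (m+[n∸m]≡n n≤k′)) k′<2n)
      n+i≡k′ : n + toℕ (fromℕ< k′∸n<n) ≡ k′
      n+i≡k′ = trans (cong (n +_) (toℕ-fromℕ< k′∸n<n)) (m+[n∸m]≡n n≤k′)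

  nonGrowing? : ∀ w → Dec (All NonGrowing w)
  nonGrowing? = All.all? (¬? ∘ growing?)

  length-φ : ∀ c → 1 ≤ length (φ c)
  length-φ c with φ c | φ-nonErasing c
  ... | []    | φc≢[] = ⊥-elim (φc≢[] refl)
  ... | _ ∷ _ | _     = s≤s z≤n

  length-apply : ∀ w → length w ≤ length (apply φ w)
  length-apply []      = z≤n
  length-apply (c ∷ w) rewrite length-++ (φ c) {apply φ w} = +-mono-≤ (length-φ c) (length-apply w)

  length-apply-expanding : ∀ w {e} → e ∈ w → Expanding e → length w < length (apply φ w)
  length-apply-expanding (c ∷ w) (here refl) exp
    rewrite length-++ (φ c) {apply φ w} = +-mono-≤ exp (length-apply w)
  length-apply-expanding (c ∷ w) (there e∈) exp
    rewrite length-++ (φ c) {apply φ w} = +-mono-≤ (length-φ c) (length-apply-expanding w e∈ exp)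

  length-iter-mono : ∀ w {m m′} → m ≤ m′ → length (iter φ m w) ≤ length (iter φ m′ w)
  length-iter-mono w {m} {m′} m≤m′ =
    subst (λ k → length (iter φ m w) ≤ length (iter φ k w)) (m∸n+n≡m m≤m′) (grows (m′ ∸ m))
    where
    grows : ∀ d → length (iter φ m w) ≤ length (iter φ (d + m) w)
    grows zero    = ≤-refl
    grows (suc d) = ≤-trans (grows d) (length-apply (iter φ (d + m) w))

  growing⇒unbounded : ∀ {b} → Growing b → ∀ M → ∃ λ m → M < length (iter φ m [ b ])
  growing⇒unbounded {b} (k , n≤k , e , b⟶e , exp) M
    with d , d>0 , b⟶ᵗe ← ⟶-pump b⟶e n≤k = suc (k + M * d) , beyond M
    where
    expands : ∀ t → length (iter φ (k + t * d) [ b ]) < length (iter φ (suc (k + t * d)) [ b ])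
    expands t = length-apply-expanding (iter φ (k + t * d) [ b ]) (∈-iter (b⟶ᵗe t)) exp
    suc-k+t*d≤ : ∀ t → suc (k + t * d) ≤ k + suc t * d
    suc-k+t*d≤ t = subst (_≤ k + suc t * d) (+-suc k (t * d))
                     (+-monoʳ-≤ k (+-monoˡ-≤ (t * d) d>0))
    beyond : ∀ t → t < length (iter φ (suc (k + t * d)) [ b ])
    beyond zero    = <-≤-trans z<s (expands 0)
    beyond (suc t) = <-≤-trans (s≤s (beyond t))
                       (<-≤-trans (s≤s (length-iter-mono [ b ] (suc-k+t*d≤ t))) (expands (suc t)))

  Stable : Fin n → Set
  Stable d = ∀ j → ¬ ReachesExpanding j d

  nonGrowing⇒stable : ∀ {b d} → NonGrowing b → b ⟶[ n ] d → Stable d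
  nonGrowing⇒stable ¬growing b⟶d j (e , d⟶e , exp) =
    ¬growing (j + n , m≤n+m n j , e , ⟶-trans b⟶d d⟶e , exp)

  firstLetter : Fin n → Fin n
  firstLetter d with φ d | φ-nonErasing d
  ... | []    | φd≢[] = ⊥-elim (φd≢[] refl)
  ... | c ∷ _ | _     = c

  stable-φ : ∀ {d} → Stable d → φ d ≡ [ firstLetter d ]
  stable-φ {d} stable with φ d | φ-nonErasing d | (λ exp → stable 0 (d , ⟶-refl , exp))
  ... | []        | φd≢[] | _         = ⊥-elim (φd≢[] refl)
  ... | _ ∷ []    | _     | _         = refl
  ... | _ ∷ _ ∷ _ | _     | ¬expanding = ⊥-elim (¬expanding (s≤s (s≤s z≤n)))

  stable-firstLetter : ∀ {d} → Stable d → Stable (firstLetter d)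
  stable-firstLetter {d} stable j (e , d′⟶e , exp) =
    stable (j + 1) (e , ⟶-trans (⟶-one (subst (firstLetter d ∈_) (sym (stable-φ stable)) (here refl))) d′⟶e , exp)

  stable-iter : ∀ {d} → Stable d → ∀ k → iter φ k [ d ] ≡ [ (firstLetter ^ k) d ]
  stable-iter stable zero = refl
  stable-iter {d} stable (suc k) rewrite stable-iter stable k =
    trans (apply-[-] _) (stable-φ (stable-^ k))
    where
    stable-^ : ∀ k → Stable ((firstLetter ^ k) d)
    stable-^ zero    = stable
    stable-^ (suc k) = stable-firstLetter (stable-^ k)

  stable-iter-map : ∀ {w} → All Stable w → ∀ k → iter φ k w ≡ map (firstLetter ^ k) w
  stable-iter-map {[]}    []                k = iter-[] k
  stable-iter-map {d ∷ w} (stable ∷ stables) k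
    rewrite iter-++ k [ d ] w | stable-iter stable k | stable-iter-map stables k = refl

  nonGrowing-iter-stable : ∀ {w} → All NonGrowing w → All Stable (iter φ n w)
  nonGrowing-iter-stable {w} ¬growing = All.tabulate λ d∈ →
    let b , b∈ , d∈b = ∈-iter⁻ n w d∈ in nonGrowing⇒stable (All.lookup ¬growing b∈) (reach d∈b)

  -- After n steps a non-growing word is a word of stable letters, on which φ acts as a map of letters.
  nonGrowing-periodic : ∀ {w} → All NonGrowing w → ∀ {m} → n + n ≤ m → ∀ t →
                        iter φ (m + t * n !) w ≡ iter φ m w
  nonGrowing-periodic {w} ¬growing {m} 2n≤m t = begin
    iter φ (m + t * n !) w              ≡⟨ cong (λ k → iter φ (k + t * n !) w) (m∸n+n≡m n≤m) ⟨
    iter φ (m ∸ n + n + t * n !) w      ≡⟨ cong (λ k → iter φ k w) (xy∙z≈xz∙y (m ∸ n) n (t * n !)) ⟩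
    iter φ (m ∸ n + t * n ! + n) w      ≡⟨ iter-+ (m ∸ n + t * n !) n w ⟩
    iter φ (m ∸ n + t * n !) (iter φ n w) ≡⟨ stable-iter-map stables (m ∸ n + t * n !) ⟩
    map (firstLetter ^ (m ∸ n + t * n !)) (iter φ n w)
      ≡⟨ map-cong (λ c → ^-eventually-periodic firstLetter c n≤m∸n t) (iter φ n w) ⟩
    map (firstLetter ^ (m ∸ n)) (iter φ n w) ≡⟨ stable-iter-map stables (m ∸ n) ⟨
    iter φ (m ∸ n) (iter φ n w)         ≡⟨ iter-+ (m ∸ n) n w ⟨
    iter φ (m ∸ n + n) w                ≡⟨ cong (λ k → iter φ k w) (m∸n+n≡m n≤m) ⟩
    iter φ m w                          ∎
    where
    open ≡-Reasoning
    stables = nonGrowing-iter-stable ¬growing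
    n≤m = ≤-trans (m≤m+n n n) 2n≤m
    n≤m∸n = subst (_≤ m ∸ n) (m+n∸n≡m n n) (∸-monoˡ-≤ n 2n≤m)

  nonGrowing⇒Bounded : ∀ {w} → All NonGrowing w → Bounded φ w
  nonGrowing⇒Bounded {w} ¬growing = n + n , n ! , 1≤n! n , λ m 2n≤m →
    trans (cong (λ p → iter φ (m + p) w) (sym (*-identityˡ (n !)))) (nonGrowing-periodic ¬growing 2n≤m 1)

  Bounded⇒nonGrowing : ∀ {w} → Bounded φ w → All NonGrowing w
  Bounded⇒nonGrowing {w} (N , p , p>0 , periodic) = All.tabulate λ b∈ growing →
    let m , M<length = growing⇒unbounded growing (length (iter φ N w)) in
    <⇒≱ M<length (≤-trans (length-⊑ (iter-⊑ m (∈⇒[]⊑ b∈))) (bounded m))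
    where
    periodic* : ∀ t → iter φ (N + t * p) w ≡ iter φ N w
    periodic* zero    = cong (λ k → iter φ k w) (+-identityʳ N)
    periodic* (suc t) = begin
      iter φ (N + (p + t * p)) w ≡⟨ cong (λ k → iter φ k w) (+-assoc N p (t * p)) ⟨
      iter φ (N + p + t * p) w   ≡⟨ cong (λ k → iter φ k w) (xy∙z≈xz∙y N p (t * p)) ⟩
      iter φ (N + t * p + p) w   ≡⟨ periodic (N + t * p) (m≤m+n N (t * p)) ⟩
      iter φ (N + t * p) w       ≡⟨ periodic* t ⟩
      iter φ N w                 ∎
      where open ≡-Reasoning
    bounded : ∀ m → length (iter φ m w) ≤ length (iter φ N w)
    bounded m = subst (λ z → length (iter φ m w) ≤ length z) (periodic* m)
                  (length-iter-mono w (≤-trans (m≤m*n m p ⦃ >-nonZero p>0 ⦄) (m≤n+m (m * p) N)))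

  nonGrowing-φ : ∀ {b} → NonGrowing b → All NonGrowing (φ b)
  nonGrowing-φ ¬growing = All.tabulate λ d∈ (k , n≤k , e , d⟶e , exp) →
    ¬growing (suc k , m≤n⇒m≤1+n n≤k , e , ⟶-cons d∈ d⟶e , exp)

  nonGrowing-apply : ∀ {w} → All NonGrowing w → All NonGrowing (apply φ w)
  nonGrowing-apply []                   = []
  nonGrowing-apply (¬growing ∷ ¬growings) = All.++⁺ (nonGrowing-φ ¬growing) (nonGrowing-apply ¬growings)

  nonGrowing-iter : ∀ k {w} → All NonGrowing w → All NonGrowing (iter φ k w)
  nonGrowing-iter zero    ¬growings = ¬growings
  nonGrowing-iter (suc k) ¬growings = nonGrowing-apply (nonGrowing-iter k ¬growings)

  growing-φ : ∀ {b} → Growing b → ∃ λ d → d ∈ φ b × Growing d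
  growing-φ {b} (k , n≤k , e , b⟶e , exp) with ⟶-pump b⟶e n≤k
  ... | suc d , _ , b⟶ᵗe
    with c , c∈ , c⟶e ← ⟶-uncons (subst (b ⟶[_] e) (trans (cong (k +_) (*-identityˡ (suc d))) (+-suc k d))
                                          (b⟶ᵗe 1)) =
    c , c∈ , k + d , ≤-trans n≤k (m≤m+n k d) , e , c⟶e , exp

  growing-iter : ∀ {b} → Growing b → ∀ k → ∃ λ d → b ⟶[ k ] d × Growing d
  growing-iter {b} growing zero = b , ⟶-refl , growing
  growing-iter growing (suc k)
    with c , b⟶c , growing-c ← growing-iter growing k
    with d , d∈ , growing-d ← growing-φ growing-c =
    d , ⟶-trans b⟶c (⟶-one d∈) , growing-d

module Decomposition {n : ℕ} (φ : Subst n) (φ-nonErasing : NonErasing φ) where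
  open Growth φ φ-nonErasing

  -- A word is a non-growing lead followed by blocks: a growing letter and the non-growing word after it.
  Block : Set
  Block = Fin n × Word n

  GoodBlock : Block → Set
  GoodBlock (c , β) = Growing c × All NonGrowing β

  flatten : List Block → Word n
  flatten []            = []
  flatten ((c , β) ∷ B) = c ∷ β ++ flatten B

  blocks : Word n → Word n × List Block
  blocks [] = [] , []
  blocks (c ∷ w) with growing? c
  ... | yes _ = [] , (c , proj₁ (blocks w)) ∷ proj₂ (blocks w)
  ... | no  _ = c ∷ proj₁ (blocks w) , proj₂ (blocks w)

  lead : Word n → Word n
  lead w = proj₁ (blocks w)

  body : Word n → List Block
  body w = proj₂ (blocks w)

  lead++flatten-body : ∀ w → lead w ++ flatten (body w) ≡ w
  lead++flatten-body [] = refl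
  lead++flatten-body (c ∷ w) with growing? c
  ... | yes _ = cong (c ∷_) (lead++flatten-body w)
  ... | no  _ = cong (c ∷_) (lead++flatten-body w)

  lead-nonGrowing : ∀ w → All NonGrowing (lead w)
  lead-nonGrowing [] = []
  lead-nonGrowing (c ∷ w) with growing? c
  ... | yes _        = []
  ... | no ¬growing = ¬growing ∷ lead-nonGrowing w

  body-good : ∀ w → All GoodBlock (body w)
  body-good [] = []
  body-good (c ∷ w) with growing? c
  ... | yes growing = (growing , lead-nonGrowing w) ∷ body-good w
  ... | no  _       = body-good w

  blocks-nonGrowing : ∀ {S} → All NonGrowing S → blocks S ≡ (S , [])
  blocks-nonGrowing [] = refl
  blocks-nonGrowing {c ∷ S} (¬growing ∷ ¬growings) with growing? c
  ... | yes growing = ⊥-elim (¬growing growing)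
  ... | no  _       rewrite blocks-nonGrowing ¬growings = refl

  blocks-first : ∀ {P c} R → All NonGrowing P → Growing c →
                 blocks (P ++ c ∷ R) ≡ (P , (c , lead R) ∷ body R)
  blocks-first {[]} {c} R [] growing with growing? c
  ... | yes _        = refl
  ... | no ¬growing = ⊥-elim (¬growing growing)
  blocks-first {p ∷ P} R (¬growing ∷ ¬growings) growing with growing? p
  ... | yes growing-p = ⊥-elim (¬growing growing-p)
  ... | no  _         rewrite blocks-first R ¬growings growing = refl

  body-nonEmpty : ∀ w {c} → c ∈ w → Growing c → ∃₂ λ b B → body w ≡ b ∷ B
  body-nonEmpty (d ∷ w) c∈ growing with growing? d | c∈
  ... | yes _         | _         = _ , _ , refl
  ... | no ¬growing   | here refl = ⊥-elim (¬growing growing)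
  ... | no _          | there c∈w = body-nonEmpty w c∈w growing

  firstBlock : Block → List Block → Block
  firstBlock b []      = b
  firstBlock _ (b ∷ _) = b

  lastBlock : Block → List Block → Block
  lastBlock b []      = b
  lastBlock _ (b ∷ B) = lastBlock b B

  blocks-last : ∀ P {c S} b → Growing c → All NonGrowing S →
                lastBlock b (body (P ++ c ∷ S)) ≡ (c , S)
  blocks-last [] {c} b growing ¬growings with growing? c
  ... | yes _        rewrite blocks-nonGrowing ¬growings = refl
  ... | no ¬growing = ⊥-elim (¬growing growing)
  blocks-last (p ∷ P) {c} {S} b growing ¬growings with growing? p
  ... | no  _ = blocks-last P b growing ¬growings
  ... | yes _ = blocks-last P (p , lead (P ++ c ∷ S)) growing ¬growings

  lastBlock-∈ : ∀ b B → lastBlock b B ∈ b ∷ B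
  lastBlock-∈ b []       = here refl
  lastBlock-∈ _ (b ∷ B) = there (lastBlock-∈ b B)

  flatten-lastBlock : ∀ b B → ∃ λ Y → flatten (b ∷ B) ≡ Y ++ proj₁ (lastBlock b B) ∷ proj₂ (lastBlock b B)
  flatten-lastBlock (c , β) []      = [] , cong (c ∷_) (++-identityʳ β)
  flatten-lastBlock (c , β) (b ∷ B) with Y , flatten≡ ← flatten-lastBlock b B =
    c ∷ β ++ Y , cong (c ∷_) (trans (cong (β ++_) flatten≡) (sym (++-assoc β Y _)))

  lastBlock-split : ∀ w b {c} → c ∈ w → Growing c →
    ∃ λ P → w ≡ P ++ proj₁ (lastBlock b (body w)) ∷ proj₂ (lastBlock b (body w))
            × GoodBlock (lastBlock b (body w))
  lastBlock-split w b c∈ growing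
    with body w | body-good w | lead++flatten-body w | body-nonEmpty w c∈ growing
  ... | _ | good | w≡ | b′ , B , refl with Y , flatten≡ ← flatten-lastBlock b′ B =
    lead w ++ Y , trans (sym w≡) (trans (cong (lead w ++_) flatten≡) (sym (++-assoc (lead w) Y _))) ,
    All.lookup good (lastBlock-∈ b′ B)

  firstBlock-split : ∀ w b {c} → c ∈ w → Growing c →
    ∃ λ R → w ≡ lead w ++ proj₁ (firstBlock b (body w)) ∷ R × Growing (proj₁ (firstBlock b (body w)))
  firstBlock-split w b c∈ growing
    with body w | body-good w | lead++flatten-body w | body-nonEmpty w c∈ growing
  ... | _ | (growing-f , _) ∷ _ | w≡ | (f , β) , B , refl = β ++ flatten B , sym w≡ , growing-f

  appendToLast : List Block → Word n → List Block
  appendToLast []                 u = []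
  appendToLast ((c , γ) ∷ [])     u = (c , γ ++ u) ∷ []
  appendToLast (b ∷ B@(_ ∷ _))    u = b ∷ appendToLast B u

  ∈-flatten : ∀ {c γ} B → (c , γ) ∈ B → c ∈ flatten B
  ∈-flatten (_ ∷ B)       (here refl) = here refl
  ∈-flatten ((_ , β) ∷ B) (there b∈)  = there (∈-++⁺ʳ β (∈-flatten B b∈))

  flatten-++ : ∀ B B′ → flatten (B ++ B′) ≡ flatten B ++ flatten B′
  flatten-++ []            B′ = refl
  flatten-++ ((c , β) ∷ B) B′ =
    cong (c ∷_) (trans (cong (β ++_) (flatten-++ B B′)) (sym (++-assoc β (flatten B) (flatten B′))))

  flatten-appendToLast : ∀ b B u → flatten (appendToLast (b ∷ B) u) ≡ flatten (b ∷ B) ++ u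
  flatten-appendToLast (c , γ) [] u =
    cong (c ∷_) (trans (++-identityʳ (γ ++ u)) (cong (_++ u) (sym (++-identityʳ γ))))
  flatten-appendToLast (c , γ) (b ∷ B) u =
    cong (c ∷_) (trans (cong (γ ++_) (flatten-appendToLast b B u)) (sym (++-assoc γ (flatten (b ∷ B)) u)))

  appendToLast-good : ∀ B {u} → All GoodBlock B → All NonGrowing u → All GoodBlock (appendToLast B u)
  appendToLast-good []                   _                                    _ = []
  appendToLast-good ((c , γ) ∷ [])       ((growing , ¬growings) ∷ [])         ¬growings-u =
    (growing , All.++⁺ ¬growings ¬growings-u) ∷ []
  appendToLast-good (b ∷ B@(_ ∷ _))      (good ∷ goods)                       ¬growings-u =
    good ∷ appendToLast-good B goods ¬growings-u

  appendToLast-head : ∀ c γ B u → ∃₂ λ γ′ B′ → appendToLast ((c , γ) ∷ B) u ≡ (c , γ′) ∷ B′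
  appendToLast-head c γ []      u = _ , _ , refl
  appendToLast-head c γ (_ ∷ _) u = _ , _ , refl

module Power {n : ℕ} (φ : Subst n) (φ-nonErasing : NonErasing φ) where
  open Morphism φ
  open Growth φ φ-nonErasing
  open Decomposition φ φ-nonErasing
  open Iteration using (^-+; ^-eventually-periodic)
  open Endo (Fin n) using (_^_)

  -- A multiple of n! that is at least 2n: φ^T acts idempotently on non-growing words.
  T : ℕ
  T = (n + n) * n !

  2n≤T : n + n ≤ T
  2n≤T = m≤m*n (n + n) (n !) ⦃ >-nonZero (1≤n! n) ⦄

  n≤T : n ≤ T
  n≤T = ≤-trans (m≤m+n n n) 2n≤T

  ψ : Subst n
  ψ b = iter φ T [ b ]

  Ψ : Word n → Word n
  Ψ = apply ψ

  module Ψ = Morphism ψ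

  Ψ≡iter : ∀ w → Ψ w ≡ iter φ T w
  Ψ≡iter []      = sym (iter-[] T)
  Ψ≡iter (c ∷ w) = trans (cong (ψ c ++_) (Ψ≡iter w)) (sym (iter-++ T [ c ] w))

  iter-ψ : ∀ m w → iter ψ m w ≡ iter φ (m * T) w
  iter-ψ zero    w = refl
  iter-ψ (suc m) w =
    trans (cong Ψ (iter-ψ m w)) (trans (Ψ≡iter (iter φ (m * T) w)) (sym (iter-+ T (m * T) w)))

  nonGrowing-Ψ : ∀ {w} → All NonGrowing w → All NonGrowing (Ψ w)
  nonGrowing-Ψ {w} ¬growings = subst (All NonGrowing) (sym (Ψ≡iter w)) (nonGrowing-iter T ¬growings)

  Ψ≢[] : ∀ {s} → s ≢ [] → Ψ s ≢ []
  Ψ≢[] {s} s≢[] Ψs≡[] = <⇒≱ (≢[]⇒length>0 s≢[])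
    (≤-trans (length-iter-mono s {0} {T} z≤n) (≤-reflexive (cong length (trans (sym (Ψ≡iter s)) Ψs≡[]))))

  Ψ-idempotent : ∀ {w} → All NonGrowing w → Ψ (Ψ w) ≡ Ψ w
  Ψ-idempotent {w} ¬growings = begin
    Ψ (Ψ w)           ≡⟨ trans (Ψ≡iter (Ψ w)) (cong (iter φ T) (Ψ≡iter w)) ⟩
    iter φ T (iter φ T w) ≡⟨ iter-+ T T w ⟨
    iter φ (T + T) w  ≡⟨ nonGrowing-periodic ¬growings 2n≤T (n + n) ⟩
    iter φ T w        ≡⟨ Ψ≡iter w ⟨
    Ψ w               ∎
    where open ≡-Reasoning

  Ψ-idempotent-middle : ∀ s {γ} p → All NonGrowing γ → Ψ (s ++ γ ++ p) ≡ Ψ (s ++ Ψ γ ++ p)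
  Ψ-idempotent-middle s {γ} p ¬growings = begin
    Ψ (s ++ γ ++ p)         ≡⟨ Ψ.apply-++ s (γ ++ p) ⟩
    Ψ s ++ Ψ (γ ++ p)       ≡⟨ cong (Ψ s ++_) (Ψ.apply-++ γ p) ⟩
    Ψ s ++ Ψ γ ++ Ψ p       ≡⟨ cong (λ w → Ψ s ++ w ++ Ψ p) (Ψ-idempotent ¬growings) ⟨
    Ψ s ++ Ψ (Ψ γ) ++ Ψ p   ≡⟨ cong (Ψ s ++_) (Ψ.apply-++ (Ψ γ) p) ⟨
    Ψ s ++ Ψ (Ψ γ ++ p)     ≡⟨ Ψ.apply-++ s (Ψ γ ++ p) ⟨
    Ψ (s ++ Ψ γ ++ p)       ∎
    where open ≡-Reasoning

  -- The last (first) growing letter of φ(d) or ψ(d), and the non-growing word after (before) it;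
  -- junk when d is non-growing.
  φ-last φ-first ψ-last ψ-first : Fin n → Fin n
  φ-last d  = proj₁ (lastBlock (d , []) (body (φ d)))
  φ-first d = proj₁ (firstBlock (d , []) (body (φ d)))
  ψ-last d  = proj₁ (lastBlock (d , []) (body (ψ d)))
  ψ-first d = proj₁ (firstBlock (d , []) (body (ψ d)))

  ψ-suffix ψ-prefix : Fin n → Word n
  ψ-suffix d = proj₂ (lastBlock (d , []) (body (ψ d)))
  ψ-prefix d = lead (ψ d)

  ψ-split-last : ∀ {d} → Growing d →
    ∃ λ P → ψ d ≡ P ++ ψ-last d ∷ ψ-suffix d × Growing (ψ-last d) × All NonGrowing (ψ-suffix d)
  ψ-split-last {d} growing with c , reach c∈ , growing-c ← growing-iter growing T =
    lastBlock-split (ψ d) (d , []) c∈ growing-c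

  ψ-split-first : ∀ {d} → Growing d →
    ∃ λ R → ψ d ≡ ψ-prefix d ++ ψ-first d ∷ R × Growing (ψ-first d) × All NonGrowing (ψ-prefix d)
  ψ-split-first {d} growing with c , reach c∈ , growing-c ← growing-iter growing T
    with R , ψd≡ , growing-f ← firstBlock-split (ψ d) (d , []) c∈ growing-c =
    R , ψd≡ , growing-f , lead-nonGrowing (ψ d)

  iter-φ-last : ∀ {d} → Growing d → ∀ k → ∃₂ λ P S →
    iter φ k [ d ] ≡ P ++ (φ-last ^ k) d ∷ S × All NonGrowing S × Growing ((φ-last ^ k) d)
  iter-φ-last growing zero = [] , [] , refl , [] , growing
  iter-φ-last {d} growing (suc k)
    with P , S , iter≡ , ¬growings , growing-c ← iter-φ-last growing k
    with c′ , c′∈ , growing-c′ ← growing-φ growing-c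
    with P′ , φc≡ , growing-l , ¬growings-l ← lastBlock-split (φ ((φ-last ^ k) d)) _ c′∈ growing-c′ =
    apply φ P ++ P′ , _ ++ apply φ S ,
    trans (cong (apply φ) iter≡) (apply-middle P S φc≡) ,
    All.++⁺ ¬growings-l (nonGrowing-apply ¬growings) , growing-l

  iter-φ-first : ∀ {d} → Growing d → ∀ k → ∃₂ λ P R →
    iter φ k [ d ] ≡ P ++ (φ-first ^ k) d ∷ R × All NonGrowing P × Growing ((φ-first ^ k) d)
  iter-φ-first growing zero = [] , [] , refl , [] , growing
  iter-φ-first {d} growing (suc k)
    with P , R , iter≡ , ¬growings , growing-c ← iter-φ-first growing k
    with c′ , c′∈ , growing-c′ ← growing-φ growing-c
    with R′ , φc≡ , growing-f ← firstBlock-split (φ ((φ-first ^ k) d)) _ c′∈ growing-c′ =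
    apply φ P ++ lead (φ ((φ-first ^ k) d)) , R′ ++ apply φ R ,
    trans (cong (apply φ) iter≡) (apply-middle P R φc≡) ,
    All.++⁺ (nonGrowing-apply ¬growings) (lead-nonGrowing (φ ((φ-first ^ k) d))) , growing-f

  ψ-last≡ : ∀ {d} → Growing d → ψ-last d ≡ (φ-last ^ T) d
  ψ-last≡ {d} growing with P , S , ψd≡ , ¬growings , growing-l ← iter-φ-last growing T =
    cong proj₁ (trans (cong (λ w → lastBlock (d , []) (body w)) ψd≡)
                      (blocks-last P (d , []) growing-l ¬growings))

  ψ-first≡ : ∀ {d} → Growing d → ψ-first d ≡ (φ-first ^ T) d
  ψ-first≡ {d} growing with P , R , ψd≡ , ¬growings , growing-f ← iter-φ-first growing T =
    trans (cong (λ w → proj₁ (firstBlock (d , []) (body w))) ψd≡)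
          (cong (λ B → proj₁ (firstBlock (d , []) (proj₂ B))) (blocks-first R ¬growings growing-f))

  ^T-idempotent : ∀ {f g : Fin n → Fin n} → (∀ {d} → Growing d → f d ≡ (g ^ T) d) →
                  (∀ {d} → Growing d → Growing (f d)) → ∀ {d} → Growing d → f (f d) ≡ f d
  ^T-idempotent {f} {g} f≡g^T growing-f {d} growing = begin
    f (f d)              ≡⟨ f≡g^T (growing-f growing) ⟩
    (g ^ T) (f d)        ≡⟨ cong (g ^ T) (f≡g^T growing) ⟩
    (g ^ T) ((g ^ T) d)  ≡⟨ ^-+ g T T d ⟨
    (g ^ (T + T)) d      ≡⟨ ^-eventually-periodic g d n≤T (n + n) ⟩
    (g ^ T) d            ≡⟨ f≡g^T growing ⟨
    f d                  ∎
    where open ≡-Reasoning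

  ψ-last-idempotent : ∀ {d} → Growing d → ψ-last (ψ-last d) ≡ ψ-last d
  ψ-last-idempotent = ^T-idempotent ψ-last≡ (λ growing → proj₁ (proj₂ (proj₂ (ψ-split-last growing))))

  ψ-first-idempotent : ∀ {d} → Growing d → ψ-first (ψ-first d) ≡ ψ-first d
  ψ-first-idempotent = ^T-idempotent ψ-first≡ (λ growing → proj₁ (proj₂ (proj₂ (ψ-split-first growing))))

  gap⊑Ψ : ∀ {c c′} γ → Growing c → Growing c′ →
          ψ-suffix c ++ Ψ γ ++ ψ-prefix c′ ⊑ Ψ (c ∷ γ ++ [ c′ ])
  gap⊑Ψ {c} {c′} γ growing growing′
    with P , ψc≡ , _ ← ψ-split-last growing
    with R , ψc′≡ , _ ← ψ-split-first growing′ =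
    subst (_ ⊑_) (sym Ψ≡)
          (⊑-middle (P ++ [ ψ-last c ]) (ψ-suffix c) (Ψ γ) (ψ-prefix c′) (ψ-first c′ ∷ R ++ []))
    where
    Ψ≡ : Ψ (c ∷ γ ++ [ c′ ]) ≡
         ((P ++ [ ψ-last c ]) ++ ψ-suffix c) ++ Ψ γ ++ ψ-prefix c′ ++ ψ-first c′ ∷ R ++ []
    Ψ≡ = trans (cong (ψ c ++_) (Ψ.apply-++ γ [ c′ ]))
               (cong₂ (λ u w → u ++ Ψ γ ++ w) (trans ψc≡ (sym (++-assoc P [ ψ-last c ] _)))
                                               (trans (cong (_++ []) ψc′≡) (++-assoc (ψ-prefix c′) _ [])))

  ψ-suffix⊑ψ : ∀ {d} → Growing d → ψ-suffix d ⊑ ψ d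
  ψ-suffix⊑ψ {d} growing with P , ψd≡ , _ ← ψ-split-last growing =
    subst (ψ-suffix d ⊑_) (sym ψd≡) (⊑-++ˡ P (suffix⊑ [ ψ-last d ] (ψ-suffix d)))

  ψ-body-nonEmpty : ∀ {d} → Growing d → ∃₂ λ b B → body (ψ d) ≡ b ∷ B
  ψ-body-nonEmpty {d} growing with c , reach c∈ , growing-c ← growing-iter growing T =
    body-nonEmpty (ψ d) c∈ growing-c

  flatten-body⊑ψ : ∀ d → flatten (body (ψ d)) ⊑ ψ d
  flatten-body⊑ψ d = subst (flatten (body (ψ d)) ⊑_) (lead++flatten-body (ψ d)) (suffix⊑ (ψ-prefix d) _)

  prefixAfter : List Block → Word n → Word n
  prefixAfter []            q = q
  prefixAfter ((d , _) ∷ _) q = ψ-prefix d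

  refine : List Block → List Block
  refine []            = []
  refine ((d , β) ∷ B) = appendToLast (body (ψ d)) (Ψ β ++ prefixAfter B []) ++ refine B

  prefixAfter-++ : ∀ B B′ q → prefixAfter (B ++ B′) q ≡ prefixAfter B (prefixAfter B′ q)
  prefixAfter-++ []      B′ q = refl
  prefixAfter-++ (_ ∷ _) B′ q = refl

  prefixAfter-appendToLast : ∀ c γ B u q → prefixAfter (appendToLast ((c , γ) ∷ B) u) q ≡ ψ-prefix c
  prefixAfter-appendToLast c γ []      u q = refl
  prefixAfter-appendToLast c γ (_ ∷ _) u q = refl

  prefixAfter-nonGrowing : ∀ {B} → All GoodBlock B → All NonGrowing (prefixAfter B [])
  prefixAfter-nonGrowing []               = []
  prefixAfter-nonGrowing {(d , _) ∷ _} _ = lead-nonGrowing (ψ d)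

  refine-good : ∀ {B} → All GoodBlock B → All GoodBlock (refine B)
  refine-good []                                      = []
  refine-good {(d , β) ∷ B} ((_ , ¬growings) ∷ goods) =
    All.++⁺ (appendToLast-good (body (ψ d)) (body-good (ψ d))
                               (All.++⁺ (nonGrowing-Ψ ¬growings) (prefixAfter-nonGrowing goods)))
            (refine-good goods)

  Ψ-flatten : ∀ {B} → All GoodBlock B → Ψ (flatten B) ≡ prefixAfter B [] ++ flatten (refine B)
  Ψ-flatten [] = refl
  Ψ-flatten {(d , β) ∷ B} ((growing , _) ∷ goods)
    with b , B′ , body≡ ← ψ-body-nonEmpty growing = begin
    ψ d ++ Ψ (β ++ flatten B)
      ≡⟨ cong (ψ d ++_) (trans (Ψ.apply-++ β (flatten B)) (cong (Ψ β ++_) (Ψ-flatten goods))) ⟩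
    ψ d ++ Ψ β ++ prefixAfter B [] ++ flatten (refine B)
      ≡⟨ cong (_++ _) (lead++flatten-body (ψ d)) ⟨
    (ψ-prefix d ++ flatten (body (ψ d))) ++ Ψ β ++ prefixAfter B [] ++ flatten (refine B)
      ≡⟨ ++-assoc (ψ-prefix d) _ _ ⟩
    ψ-prefix d ++ flatten (body (ψ d)) ++ Ψ β ++ prefixAfter B [] ++ flatten (refine B)
      ≡⟨ cong (λ w → ψ-prefix d ++ flatten (body (ψ d)) ++ w) (++-assoc (Ψ β) _ _) ⟨
    ψ-prefix d ++ flatten (body (ψ d)) ++ u ++ flatten (refine B)
      ≡⟨ cong (ψ-prefix d ++_) (++-assoc (flatten (body (ψ d))) u _) ⟨
    ψ-prefix d ++ (flatten (body (ψ d)) ++ u) ++ flatten (refine B)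
      ≡⟨ cong (λ w → ψ-prefix d ++ w ++ flatten (refine B)) flatten-last ⟨
    ψ-prefix d ++ flatten (appendToLast (body (ψ d)) u) ++ flatten (refine B)
      ≡⟨ cong (ψ-prefix d ++_) (flatten-++ (appendToLast (body (ψ d)) u) (refine B)) ⟨
    ψ-prefix d ++ flatten (appendToLast (body (ψ d)) u ++ refine B) ∎
    where
    open ≡-Reasoning
    u = Ψ β ++ prefixAfter B []
    flatten-last : flatten (appendToLast (body (ψ d)) u) ≡ flatten (body (ψ d)) ++ u
    flatten-last rewrite body≡ = flatten-appendToLast b B′ u

module Prolongation {n : ℕ} (φ : Subst n) (φ-nonErasing : NonErasing φ)
                    {a : Fin n} {v : Word n} (φa≡ : φ a ≡ a ∷ v) (v≢[] : v ≢ []) where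
  open Morphism φ
  open Growth φ φ-nonErasing
  open Decomposition φ φ-nonErasing
  open Power φ φ-nonErasing

  iter-a : ∀ k → ∃ λ r → iter φ k [ a ] ≡ a ∷ r
  iter-a zero = [] , refl
  iter-a (suc k) with r , iter≡ ← iter-a k =
    v ++ apply φ r , trans (cong (apply φ) iter≡) (cong (_++ apply φ r) φa≡)

  a⟶a : ∀ k → a ⟶[ k ] a
  a⟶a k = reach (subst (a ∈_) (sym (proj₂ (iter-a k))) (here refl))

  expanding-a : Expanding a
  expanding-a = subst (λ w → 2 ≤ length w) (sym φa≡) (s≤s (≢[]⇒length>0 v≢[]))

  growing-a : Growing a
  growing-a = n , ≤-refl , a , a⟶a n , expanding-a

  ψa-tail : Word n
  ψa-tail = proj₁ (iter-a T)

  blocks-ψa : blocks (ψ a) ≡ ([] , (a , lead ψa-tail) ∷ body ψa-tail)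
  blocks-ψa = trans (cong blocks (proj₂ (iter-a T))) (blocks-first ψa-tail [] growing-a)

  level : ℕ → Word n
  level m = iter ψ m [ a ]

  levelBlocks : ℕ → List Block
  levelBlocks zero    = [ (a , []) ]
  levelBlocks (suc m) = refine (levelBlocks m)

  levelBlocks-good : ∀ m → All GoodBlock (levelBlocks m)
  levelBlocks-good zero    = (growing-a , []) ∷ []
  levelBlocks-good (suc m) = refine-good (levelBlocks-good m)

  levelBlocks-head : ∀ m → ∃₂ λ β B → levelBlocks m ≡ (a , β) ∷ B
  levelBlocks-head zero = _ , _ , refl
  levelBlocks-head (suc m) with β , B , blocks≡ ← levelBlocks-head m rewrite blocks≡ | cong proj₂ blocks-ψa
    with γ′ , B′ , append≡ ← appendToLast-head a (lead ψa-tail) (body ψa-tail) (Ψ β ++ prefixAfter B [])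
    rewrite append≡ = γ′ , B′ ++ refine B , refl

  prefixAfter-levelBlocks : ∀ m → prefixAfter (levelBlocks m) [] ≡ []
  prefixAfter-levelBlocks m with β , B , blocks≡ ← levelBlocks-head m rewrite blocks≡ = cong proj₁ blocks-ψa

  level≡flatten : ∀ m → level m ≡ flatten (levelBlocks m)
  level≡flatten zero    = refl
  level≡flatten (suc m) =
    trans (cong Ψ (level≡flatten m))
          (trans (Ψ-flatten (levelBlocks-good m)) (cong (_++ flatten (levelBlocks (suc m))) (prefixAfter-levelBlocks m)))

  -- The letters occurring in φ^∞(a) are exactly those of ψ(a).
  Occurring : Fin n → Set
  Occurring c = c ∈ ψ a

  reachable⇒occurring : ∀ {k c} → a ⟶[ k ] c → Occurring c
  reachable⇒occurring {c = c} a⟶c with k′ , k′<n , a⟶′c ← ⟶-bounded a⟶c =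
    ∈-iter (subst (a ⟶[_] c) (m+[n∸m]≡n (≤-trans (<⇒≤ k′<n) n≤T)) (⟶-trans (a⟶a (T ∸ k′)) a⟶′c))

  level≡iter : ∀ m → level m ≡ iter φ (m * T) [ a ]
  level≡iter m = iter-ψ m [ a ]

  level-occurring : ∀ m {c} → c ∈ level m → Occurring c
  level-occurring m c∈ = reachable⇒occurring (reach {k = m * T} (subst (_ ∈_) (level≡iter m) c∈))

  level-suc : ∀ m → level (suc m) ≡ iter ψ m (ψ a)
  level-suc m = trans (Ψ.iter-suc m [ a ]) (cong (iter ψ m) (Ψ.apply-[-] a))

  level-⊑-suc : ∀ m → level m ⊑ level (suc m)
  level-⊑-suc m = [] , iter ψ m ψa-tail ,
    trans (level-suc m) (trans (cong (iter ψ m) (proj₂ (iter-a T))) (Ψ.iter-++ m [ a ] ψa-tail))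

  level-⊑ : ∀ {m m′} → m ≤ m′ → level m ⊑ level m′
  level-⊑ m≤m′ = ⊑-later (≤⇒≤′ m≤m′)
    where
    ⊑-later : ∀ {m m′} → m ≤′ m′ → level m ⊑ level m′
    ⊑-later ≤′-refl                       = ⊑-refl _
    ⊑-later {m′ = suc m′} (≤′-step m≤′m′) = ⊑-trans (⊑-later m≤′m′) (level-⊑-suc m′)

  occurring-iter-⊑ : ∀ {c} → Occurring c → ∀ j → iter ψ j [ c ] ⊑ level (suc j)
  occurring-iter-⊑ c∈ j = subst (_ ⊑_) (sym (level-suc j)) (Ψ.iter-⊑ j (∈⇒[]⊑ c∈))

  ψ⊑level₂ : ∀ {d} → Occurring d → ψ d ⊑ level 2
  ψ⊑level₂ {d} occurring = subst (_⊑ level 2) (Ψ.apply-[-] d) (occurring-iter-⊑ occurring 1)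

  occurring-ψ : ∀ {c d} → Occurring d → c ∈ ψ d → Occurring c
  occurring-ψ occurring c∈ = level-occurring 2 (∈-⊑ c∈ (ψ⊑level₂ occurring))

  length-iter-a : ∀ k → k < length (iter φ k [ a ])
  length-iter-a zero    = z<s
  length-iter-a (suc k) =
    <-≤-trans (s≤s (length-iter-a k)) (length-apply-expanding _ (∈-iter (a⟶a k)) expanding-a)

  length-level : ∀ m → m < length (level m)
  length-level m = subst (λ w → m < length w) (sym (level≡iter m))
    (≤-<-trans (m≤m*n m T ⦃ >-nonZero (≤-trans (s≤s z≤n) (≤-trans (toℕ<n a) n≤T)) ⦄)
               (length-iter-a (m * T)))

module FixedPoint {n : ℕ} (φ : Subst n) (φ-nonErasing : NonErasing φ)
                  {a : Fin n} {v : Word n} (φa≡ : φ a ≡ a ∷ v) (v≢[] : v ≢ [])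
                  (x : InfWord n) (x-fixed : IsFixedPointFrom φ a x) where
  open Morphism φ
  open Growth φ φ-nonErasing
  open Decomposition φ φ-nonErasing
  open Power φ φ-nonErasing
  open Prolongation φ φ-nonErasing φa≡ v≢[]
  open InfiniteWord x

  level-prefix : ∀ m → IsPrefix (level m) x
  level-prefix m = subst (λ w → IsPrefix w x) (sym (level≡iter m)) (x-fixed (m * T))

  ⊑level⇒factor : ∀ m {w} → w ⊑ level m → Factor w x
  ⊑level⇒factor m = ⊑prefix⇒factor (level-prefix m)

  factor⇒⊑level : ∀ {w} → Factor w x → ∃ λ m → w ⊑ level m
  factor⇒⊑level {w} factor@(i , _) =
    i + length w , factor⇒⊑prefix factor (level-prefix (i + length w)) (<⇒≤ (length-level (i + length w)))

  Repetition : Word n → Set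
  Repetition U = U ≢ [] × ((k : ℕ) → Factor (pow U k) x)

  repetition⇒infinitelyMany : ∀ {U} → All NonGrowing U → Repetition U → ¬ FinitelyManyBoundedFactors φ x
  repetition⇒infinitelyMany {U} ¬growings (U≢[] , powers) (L , complete) =
    <⇒≱ (length-pow U≢[] (suc M))
        (All.lookup (f[xs]≤f[argmax] {f = length} [] L) (complete _ (powers (suc M) , bounded)))
    where
    M = length (argmax length [] L)
    pow-nonGrowing : ∀ k → All NonGrowing (pow U k)
    pow-nonGrowing zero    = []
    pow-nonGrowing (suc k) = All.++⁺ ¬growings (pow-nonGrowing k)
    bounded = nonGrowing⇒Bounded (pow-nonGrowing (suc M))

  suffix-repetition : ∀ {h} → Occurring h → Growing h → ψ-last h ≡ h → ψ-suffix h ≢ [] →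
                      ∃ λ U → All NonGrowing U × Repetition U
  suffix-repetition {h} occurring growing last≡h suffix≢[]
    with P , ψh≡ , _ , ¬growings ← ψ-split-last growing =
    Ψ (ψ-suffix h) , nonGrowing-Ψ ¬growings , Ψ≢[] suffix≢[] , λ k →
      ⊑level⇒factor (suc (suc k))
        (⊑-trans (Ψ.pow⊑iter-right ψh≡h (Ψ-idempotent ¬growings) k) (occurring-iter-⊑ occurring (suc k)))
    where
    ψh≡h : ψ h ≡ P ++ h ∷ ψ-suffix h
    ψh≡h = subst (λ c → ψ h ≡ P ++ c ∷ ψ-suffix h) last≡h ψh≡

  prefix-repetition : ∀ {h} → Occurring h → Growing h → ψ-first h ≡ h → ψ-prefix h ≢ [] →
                      ∃ λ U → All NonGrowing U × Repetition U
  prefix-repetition {h} occurring growing first≡h prefix≢[]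
    with R , ψh≡ , _ , ¬growings ← ψ-split-first growing =
    Ψ (ψ-prefix h) , nonGrowing-Ψ ¬growings , Ψ≢[] prefix≢[] , λ k →
      ⊑level⇒factor (suc (suc k))
        (⊑-trans (Ψ.pow⊑iter-left ψh≡h (Ψ-idempotent ¬growings) k) (occurring-iter-⊑ occurring (suc k)))
    where
    ψh≡h : ψ h ≡ ψ-prefix h ++ h ∷ R
    ψh≡h = subst (λ c → ψ h ≡ ψ-prefix h ++ c ∷ R) first≡h ψh≡

  module FiniteCase
    (suffix≡[] : ∀ {h} → Occurring h → Growing h → ψ-last h ≡ h → ψ-suffix h ≡ [])
    (prefix≡[] : ∀ {h} → Occurring h → Growing h → ψ-first h ≡ h → ψ-prefix h ≡ []) where

    InLevel₄ : Word n → Set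
    InLevel₄ w = w ⊑ level 4

    module _ {d w} (occurring : Occurring d) (w⊑ψd : w ⊑ ψ d) where
      ⊑ψ⇒inLevel₄ : InLevel₄ w
      ⊑ψ⇒inLevel₄ = ⊑-trans w⊑ψd (⊑-trans (ψ⊑level₂ occurring) (level-⊑ {2} {4} (s≤s (s≤s z≤n))))

      ⊑ψ⇒Ψ-inLevel₄ : InLevel₄ (Ψ w)
      ⊑ψ⇒Ψ-inLevel₄ =
        ⊑-trans (Ψ.iter-⊑ 1 w⊑ψd)
                (⊑-trans (Ψ.iter-⊑ 1 (ψ⊑level₂ occurring)) (level-⊑ {3} {4} (s≤s (s≤s (s≤s z≤n)))))

      ⊑ψ⇒ΨΨ-inLevel₄ : InLevel₄ (Ψ (Ψ w))
      ⊑ψ⇒ΨΨ-inLevel₄ = ⊑-trans (Ψ.iter-⊑ 2 w⊑ψd) (Ψ.iter-⊑ 2 (ψ⊑level₂ occurring))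

    -- For a block (d , β) followed by a growing letter with ψ-prefix p: the non-growing words
    -- filling this gap in the current and all later levels lie in level 4.
    GapInvariant : Block → Word n → Set
    GapInvariant (d , β) p =
      InLevel₄ β × InLevel₄ (ψ-suffix d ++ Ψ β ++ p) × InLevel₄ (Ψ (ψ-suffix d ++ β ++ p))

    Invariant : List Block → Word n → Set
    Invariant []      q = ⊤
    Invariant (b ∷ B) q = GapInvariant b (prefixAfter B q) × Invariant B q

    invariant-++ : ∀ X {Y q} → Invariant X (prefixAfter Y q) → Invariant Y q → Invariant (X ++ Y) q
    invariant-++ []                _             inv-Y = inv-Y
    invariant-++ (_ ∷ [])          (gap , _)     inv-Y = gap , inv-Y
    invariant-++ (_ ∷ X@(_ ∷ _))   (gap , inv-X) inv-Y = gap , invariant-++ X inv-X inv-Y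

    appendToLast-invariant : ∀ {d} → Occurring d → ∀ b₀ C {u} → (∃₂ λ b B → C ≡ b ∷ B) →
      All GoodBlock C → flatten C ⊑ ψ d →
      GapInvariant (proj₁ (lastBlock b₀ C) , proj₂ (lastBlock b₀ C) ++ u) [] →
      Invariant (appendToLast C u) []
    appendToLast-invariant _ _ _ (_ , [] , refl) _ _ last-gap = last-gap , tt
    appendToLast-invariant {d} occurring _ _ {u} ((c , γ) , (c′ , γ′) ∷ B , refl)
      ((growing , ¬growings) ∷ goods@((growing′ , _) ∷ _)) flatten⊑ψd last-gap =
      subst (GapInvariant (c , γ)) (sym (prefixAfter-appendToLast c′ γ′ B u [])) gap ,
      appendToLast-invariant occurring (c , γ) ((c′ , γ′) ∷ B) (_ , _ , refl) goods
                             (⊑-trans (suffix⊑ (c ∷ γ) _) flatten⊑ψd) last-gap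
      where
      cγc′⊑ψd : c ∷ γ ++ [ c′ ] ⊑ ψ d
      cγc′⊑ψd = ⊑-trans ([] , γ′ ++ flatten B , cong (c ∷_) (sym (++-assoc γ [ c′ ] _))) flatten⊑ψd
      gap⊑ = gap⊑Ψ γ growing growing′
      gap : GapInvariant (c , γ) (ψ-prefix c′)
      gap = ⊑ψ⇒inLevel₄ occurring (⊑-trans (⊑-++ˡ [ c ] (prefix⊑ γ _)) flatten⊑ψd) ,
            ⊑-trans gap⊑ (⊑ψ⇒Ψ-inLevel₄ occurring cγc′⊑ψd) ,
            subst InLevel₄ (sym (Ψ-idempotent-middle (ψ-suffix c) (ψ-prefix c′) ¬growings))
                  (⊑-trans (Ψ.iter-⊑ 1 gap⊑) (⊑ψ⇒ΨΨ-inLevel₄ occurring cγc′⊑ψd))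

    ψ-suffix-last≡[] : ∀ {d} → Occurring d → Growing d → ψ-suffix (ψ-last d) ≡ []
    ψ-suffix-last≡[] occurring growing with P , ψd≡ , growing-l , _ ← ψ-split-last growing =
      suffix≡[] (occurring-ψ occurring (subst (_ ∈_) (sym ψd≡) (∈-++⁺ʳ P (here refl))))
                growing-l (ψ-last-idempotent growing)

    ψ-prefix-first≡[] : ∀ {d} → Occurring d → Growing d → ψ-prefix (ψ-first d) ≡ []
    ψ-prefix-first≡[] {d} occurring growing with R , ψd≡ , growing-f , _ ← ψ-split-first growing =
      prefix≡[] (occurring-ψ occurring (subst (_ ∈_) (sym ψd≡) (∈-++⁺ʳ (ψ-prefix d) (here refl))))
                growing-f (ψ-first-idempotent growing)

    prefixAfter-refine : ∀ {B} → All GoodBlock B → All (Occurring ∘ proj₁) B → prefixAfter (refine B) [] ≡ []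
    prefixAfter-refine [] [] = refl
    prefixAfter-refine {(d , β) ∷ B} ((growing , _) ∷ _) (occurring ∷ _)
      with body (ψ d) | ψ-body-nonEmpty growing | ψ-prefix-first≡[] occurring growing
    ... | _ | (f , γ) , C , refl | prefix≡[]′ =
      trans (prefixAfter-++ (appendToLast ((f , γ) ∷ C) _) (refine B) [])
            (trans (prefixAfter-appendToLast f γ C _ _) prefix≡[]′)

    refine-invariant : ∀ {B} → All GoodBlock B → All (Occurring ∘ proj₁) B → Invariant B [] →
                       Invariant (refine B) []
    refine-invariant [] [] tt = tt
    refine-invariant {(d , β) ∷ R} ((growing , ¬growings) ∷ goods) (occurring ∷ occurrings)
                     ((_ , suffix-gap , Ψ-gap) , inv) =
      invariant-++ (appendToLast (body (ψ d)) u)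
        (subst (Invariant _) (sym (prefixAfter-refine goods occurrings))
               (appendToLast-invariant occurring (d , []) (body (ψ d)) (ψ-body-nonEmpty growing)
                                       (body-good (ψ d)) (flatten-body⊑ψ d) last-gap))
        (refine-invariant goods occurrings inv)
      where
      u = Ψ β ++ prefixAfter R []
      Ψ-gap′ : InLevel₄ (Ψ (ψ-suffix d ++ u))
      Ψ-gap′ = subst InLevel₄ (Ψ-idempotent-middle (ψ-suffix d) (prefixAfter R []) ¬growings) Ψ-gap
      last-gap : GapInvariant (ψ-last d , ψ-suffix d ++ u) []
      last-gap rewrite ψ-suffix-last≡[] occurring growing =
        suffix-gap ,
        subst InLevel₄ (sym (++-identityʳ (Ψ (ψ-suffix d ++ u)))) Ψ-gap′ ,
        subst InLevel₄ (cong Ψ (sym (++-identityʳ (ψ-suffix d ++ u)))) Ψ-gap′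

    letters-occurring : ∀ m → All (Occurring ∘ proj₁) (levelBlocks m)
    letters-occurring m = All.tabulate λ {b} b∈ →
      level-occurring m (subst (proj₁ b ∈_) (sym (level≡flatten m)) (∈-flatten (levelBlocks m) b∈))

    levelBlocks-invariant : ∀ m → Invariant (levelBlocks m) []
    levelBlocks-invariant zero =
      ([]⊑ _ , ⊑ψ⇒inLevel₄ a-occurring suffix⊑ψa , ⊑ψ⇒Ψ-inLevel₄ a-occurring suffix⊑ψa) , tt
      where
      a-occurring : Occurring a
      a-occurring = reachable⇒occurring (a⟶a 0)
      suffix⊑ψa : ψ-suffix a ++ [] ⊑ ψ a
      suffix⊑ψa = subst (_⊑ ψ a) (sym (++-identityʳ (ψ-suffix a))) (ψ-suffix⊑ψ growing-a)
    levelBlocks-invariant (suc m) =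
      refine-invariant (levelBlocks-good m) (letters-occurring m) (levelBlocks-invariant m)

    ⊑blocks⇒inLevel₄ : ∀ {w} β B {q} → All NonGrowing w → InLevel₄ β → All GoodBlock B → Invariant B q →
                        w ⊑ β ++ flatten B → InLevel₄ w
    ⊑blocks⇒inLevel₄ β [] _ β-in _ _ w⊑ = ⊑-trans (subst (_ ⊑_) (++-identityʳ β) w⊑) β-in
    ⊑blocks⇒inLevel₄ β ((c , β′) ∷ B) ¬growings β-in ((growing , _) ∷ goods) ((β′-in , _) , inv) w⊑
      with ⊑-∉-split β (β′ ++ flatten B) (λ c∈ → All.lookup ¬growings c∈ growing) w⊑
    ... | inj₁ w⊑β    = ⊑-trans w⊑β β-in
    ... | inj₂ w⊑rest = ⊑blocks⇒inLevel₄ β′ B ¬growings β′-in goods inv w⊑rest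

    nonGrowing⊑level⇒inLevel₄ : ∀ m {w} → All NonGrowing w → w ⊑ level m → InLevel₄ w
    nonGrowing⊑level⇒inLevel₄ m {w} ¬growings w⊑
      with levelBlocks m | levelBlocks-good m | levelBlocks-invariant m | level≡flatten m | levelBlocks-head m
    ... | _ | (growing-a′ , _) ∷ goods | (β-in , _) , inv | level≡ | β , R , refl
      with ⊑-∉-split [] (β ++ flatten R) (λ a∈ → All.lookup ¬growings a∈ growing-a′)
                     (subst (w ⊑_) level≡ w⊑)
    ... | inj₁ w⊑[]   = ⊑-trans w⊑[] ([]⊑ _)
    ... | inj₂ w⊑rest = ⊑blocks⇒inLevel₄ β R ¬growings β-in goods inv w⊑rest

    boundedFactors : List (Word n)
    boundedFactors = filter nonGrowing? (factors (level 4))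

    ∈-boundedFactors : ∀ w → w ∈ boundedFactors ⇔ BoundedFactor φ x w
    ∈-boundedFactors w = mk⇔
      (λ w∈ → let w∈factors , ¬growings = ∈-filter⁻ nonGrowing? w∈ in
        ⊑level⇒factor 4 (∈-factors⁻ (level 4) w∈factors) , nonGrowing⇒Bounded ¬growings)
      (λ (factor , bounded) →
        let ¬growings = Bounded⇒nonGrowing bounded
            m , w⊑level = factor⇒⊑level factor in
        ∈-filter⁺ nonGrowing? (∈-factors⁺ (level 4) (nonGrowing⊑level⇒inLevel₄ m ¬growings w⊑level))
                  ¬growings)

  Pumping : Fin n → Set
  Pumping h = Occurring h × Growing h ×
              ((ψ-last h ≡ h × ψ-suffix h ≢ []) ⊎ (ψ-first h ≡ h × ψ-prefix h ≢ []))

  pumping? : ∀ h → Dec (Pumping h)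
  pumping? h = h ∈? ψ a ×-dec growing? h ×-dec
               ((ψ-last h Fin.≟ h ×-dec ¬? (≡-dec Fin._≟_ (ψ-suffix h) [])) ⊎-dec
                (ψ-first h Fin.≟ h ×-dec ¬? (≡-dec Fin._≟_ (ψ-prefix h) [])))
    where open import Data.List.Membership.DecPropositional Fin._≟_ using (_∈?_)

  pumping⇒repetition : ∀ {h} → Pumping h → ∃ λ U → All NonGrowing U × Repetition U
  pumping⇒repetition (occurring , growing , inj₁ (last≡h , suffix≢[])) =
    suffix-repetition occurring growing last≡h suffix≢[]
  pumping⇒repetition (occurring , growing , inj₂ (first≡h , prefix≢[])) =
    prefix-repetition occurring growing first≡h prefix≢[]

  module _ (¬pumping : ¬ ∃ Pumping) {h} (occurring : Occurring h) (growing : Growing h) where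
    ¬pumping⇒suffix≡[] : ψ-last h ≡ h → ψ-suffix h ≡ []
    ¬pumping⇒suffix≡[] last≡h =
      ¬≢[]⇒≡[] λ suffix≢[] → ¬pumping (h , occurring , growing , inj₁ (last≡h , suffix≢[]))

    ¬pumping⇒prefix≡[] : ψ-first h ≡ h → ψ-prefix h ≡ []
    ¬pumping⇒prefix≡[] first≡h =
      ¬≢[]⇒≡[] λ prefix≢[] → ¬pumping (h , occurring , growing , inj₂ (first≡h , prefix≢[]))

mainTheorem2 : (n : ℕ) (φ : Subst n) (a : Fin n) →
    NonErasing φ → Prolongable φ a →
    (x : InfWord n) → IsFixedPointFrom φ a x →
    ((¬ FinitelyManyBoundedFactors φ x) ×
       Σ (Word n) (λ U → (U ≢ []) × ((k : ℕ) → Factor (pow U k) x)))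
    ⊎ Σ (List (Word n)) (λ L → (w : Word n) → (w ∈ L ⇔ BoundedFactor φ x w))
mainTheorem2 n φ a φ-nonErasing (v , φa≡ , φᵏv≢[]) x x-fixed = classify
  where
  open FixedPoint φ φ-nonErasing φa≡ (φᵏv≢[] 0) x x-fixed
  classify : ((¬ FinitelyManyBoundedFactors φ x) × Σ (Word n) Repetition)
             ⊎ Σ (List (Word n)) (λ L → (w : Word n) → (w ∈ L ⇔ BoundedFactor φ x w))
  classify with Fin.any? pumping?
  ... | yes (_ , pumping) with U , ¬growings , repetition ← pumping⇒repetition pumping =
    inj₁ (repetition⇒infinitelyMany ¬growings repetition , U , repetition)
  ... | no ¬pumping = inj₂ (boundedFactors , ∈-boundedFactors)
    where open FiniteCase (¬pumping⇒suffix≡[] ¬pumping) (¬pumping⇒prefix≡[] ¬pumping)
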